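{- Let $G$ be a graph of order $n\ge 2$ with no isolated vertex. Then the following hold. 1. Bounds: $2\le \chi_i(G)\le n$. 2. Upper bound: $\chi_i(G)=n$ if and only if $G=K_n$. 3. Lower bound: every star $K_{1,n-1}$ satisfies $\chi_i=2$. If $G$ is not a star, then the following statements are equivalent: - (i) $\chi_i(G)=2$; - (ii) $G$ is a bipartite graph having Property $\Im_1$ or Property $\Im_2$ (for some bipartition); - (iii) $G\in\mathcal{F}_1\cup\mathcal{F}_2\cup\mathcal{F}_3$.
   Context: All graphs are finite, simple, undirected and connected. Neighborhoods and private neighbors. $N(v)$ denotes the open neighborhood and $N[v]=N(v)\cup\{v\}$ the closed neighborhood of $v$. For $S\subseteq V(G)$, $N[S]=\bigcup_{v\in S}N[v]$. For $v\in S$, $pn[v,S]=N[v]\setminus N[S\setminus\{v\}]$. Irredundance. A set $S$ is irredundant if $pn[v,S]\neq\emptyset$ for all $v\in S$. It is maximal irredundant if $S$ is irredundant and $S\cup\{w\}$ is not irredundant for every $w\notin S$. Irredundance coloring. An irredundance coloring is a proper coloring for which some maximal irredundant set $R$ has all its vertices colored pairwise differently. $\chi_i(G)$ is the minimum number of colors in an irredundance coloring. Bipartite graphs. Write $G(V_1,V_2)$ for a bipartite graph with bipartition $V_1,V_2$. Property $\Im_1$. $G(V_1,V_2)$ has Property $\Im_1$ if there exist adjacent vertices $v_1\in V_1$, $v_2\in V_2$ with $\deg(v_1)\ge 2$ and $\deg(v_2)\ge 2$ such that: - (a) every vertex of $V_2\setminus N(v_1)$ is adjacent to every vertex of $N(v_2)\setminus\{v_1\}$;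 - (b) every vertex of $V_1\setminus N(v_2)$ is adjacent to every vertex of $N(v_1)\setminus\{v_2\}$; - (c) for $\{i,j\}=\{1,2\}$, if $\deg(v_i)\ge 3$ then every $x\in N(v_i)$ satisfies at least one of: $x$ is a pendant vertex, $N(x)\subseteq N(v_j)$, or $N(x)=V_i$. Property $\Im_2$. $G(V_1,V_2)$ has Property $\Im_2$ if there exist non-adjacent $v_1\in V_1$, $v_2\in V_2$ with $N(v_1)=V_2\setminus\{v_2\}$ and $N(v_2)=V_1\setminus\{v_1\}$. Family $\mathcal{F}_1$. Let $K$ be the graph obtained from two stars, centered at $v_1$ and at $x$ and each having at least one leaf, together with a new vertex $v_2$ joined to both $v_1$ and $x$. $\mathcal{F}_1$ consists of the bipartite graphs obtained from some such $K$ by joining $x$ to some (possibly none, possibly all) of the vertices of $N_K(v_1)$. Family $\mathcal{F}_2$. $\mathcal{F}_2$ consists of the bipartite graphs $G(V_1,V_2)$ having $v_1\in V_1$, $v_2\in V_2$ with $N(v_1)=V_2$ and $N(v_2)=V_1$. Family $\mathcal{F}_3$. $\mathcal{F}_3$ consists of the bipartite graphs $G(V_1,V_2)$ having non-adjacent $v_1\in V_1$, $v_2\in V_2$ with $N(v_1)=V_2\setminus\{v_2\}$ and $N(v_2)=V_1\setminus\{v_1\}$. -}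

module Defs where

open import Data.Nat using (ℕ)
open import Data.Bool using (Bool; true; false)
open import Data.Fin using (Fin)
open import Data.Fin.Subset using (Subset; _∈_; _∉_; _∪_; ⁅_⁆; _⊆_)
open import Data.Product using (Σ; ∃; ∃-syntax; _×_; _,_)
open import Data.Sum using (_⊎_)
open import Relation.Nullary using (¬_)
open import Relation.Binary.PropositionalEquality using (_≡_; _≢_)
open import Function.Bundles using (_⇔_)

record Graph (n : ℕ) : Set where
  field
    E     : Fin n → Fin n → Bool
    sym   : ∀ u v → E u v ≡ E v u
    irrefl : ∀ v → E v v ≡ false

module _ {n : ℕ} (G : Graph n) where
  open Graph G

  Adj : Fin n → Fin n → Set
  Adj u v = E u v ≡ true

  data Reach : Fin n → Fin n → Set where
    here : ∀ {u} → Reach u u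
    step : ∀ {u v w} → Adj u v → Reach v w → Reach u w

  Connected : Set
  Connected = ∀ u v → Reach u v

  NoIsolated : Set
  NoIsolated = ∀ v → ∃[ w ] Adj v w

  InClosedNbhd : Fin n → Fin n → Set
  InClosedNbhd v w = w ≡ v ⊎ Adj v w

  PrivateNbr : Subset n → Fin n → Fin n → Set
  PrivateNbr S v w = InClosedNbhd v w × (∀ u → u ∈ S → u ≢ v → ¬ InClosedNbhd u w)

  Irredundant : Subset n → Set
  Irredundant S = ∀ v → v ∈ S → ∃[ w ] PrivateNbr S v w

  MaximalIrredundant : Subset n → Set
  MaximalIrredundant S = Irredundant S × (∀ w → w ∉ S → ¬ Irredundant (S ∪ ⁅ w ⁆))

  ProperColoring : {k : ℕ} → (Fin n → Fin k) → Set
  ProperColoring c = ∀ u v → Adj u v → c u ≢ c v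

  IrrColoring : (k : ℕ) → (Fin n → Fin k) → Set
  IrrColoring k c = ProperColoring c ×
    (∃[ R ] (MaximalIrredundant R × (∀ u v → u ∈ R → v ∈ R → u ≢ v → c u ≢ c v)))

  IrrColorable : ℕ → Set
  IrrColorable k = ∃[ c ] IrrColoring k c

  IsChiI : ℕ → Set
  IsChiI k = IrrColorable k × (∀ m → IrrColorable m → k Data.Nat.≤ m)

  Complete : Set
  Complete = ∀ u v → u ≢ v → Adj u v

  IsStar : Set
  IsStar = ∃[ c ] ((∀ v → v ≢ c → Adj c v) × (∀ u v → Adj u v → u ≡ c ⊎ v ≡ c))

  Deg≥2 : Fin n → Set
  Deg≥2 v = ∃[ a ] ∃[ b ] (a ≢ b × Adj v a × Adj v b)

  Deg≥3 : Fin n → Set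
  Deg≥3 v = ∃[ a ] ∃[ b ] ∃[ c ] (a ≢ b × a ≢ c × b ≢ c × Adj v a × Adj v b × Adj v c)

  Pendant : Fin n → Set
  Pendant x = ∃[ u ] (Adj x u × (∀ w → Adj x w → w ≡ u))

  IsBipartition : (Fin n → Bool) → Set
  IsBipartition side = ∀ u v → Adj u v → side u ≢ side v

  Bipartite : Set
  Bipartite = ∃[ side ] IsBipartition side

  module _ (side : Fin n → Bool) where
    InV₁ InV₂ : Fin n → Set
    InV₁ v = side v ≡ true
    InV₂ v = side v ≡ false

    -- condition (c) for vᵢ (with the other vertex vⱼ), where Vᵢ = {side ≡ b}
    CondC : Fin n → Fin n → Bool → Set
    CondC vi vj b = Deg≥3 vi → ∀ x → Adj vi x →
      Pendant x ⊎ (∀ z → Adj x z → Adj vj z) ⊎ (∀ z → Adj x z ⇔ side z ≡ b)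

    Property𝔍₁ : Set
    Property𝔍₁ = ∃[ v₁ ] ∃[ v₂ ] (InV₁ v₁ × InV₂ v₂ × Adj v₁ v₂ × Deg≥2 v₁ × Deg≥2 v₂ ×
      -- (a)
      (∀ y → InV₂ y → ¬ Adj v₁ y → ∀ x → Adj v₂ x → x ≢ v₁ → Adj y x) ×
      -- (b)
      (∀ x → InV₁ x → ¬ Adj v₂ x → ∀ y → Adj v₁ y → y ≢ v₂ → Adj x y) ×
      -- (c)
      CondC v₁ v₂ true × CondC v₂ v₁ false)

    Property𝔍₂ : Set
    Property𝔍₂ = ∃[ v₁ ] ∃[ v₂ ] (InV₁ v₁ × InV₂ v₂ × ¬ Adj v₁ v₂ ×
      (∀ y → Adj v₁ y ⇔ (InV₂ y × y ≢ v₂)) ×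
      (∀ x → Adj v₂ x ⇔ (InV₁ x × x ≢ v₁)))

  -- Family F₁ (up to relabelling: a labelling of the vertices realising the construction)
  -- v₁, x, v₂ distinct; L₁ = leaves of the star at v₁, the remaining vertices
  -- are the leaves L₂ of the star at x; S ⊆ L₁ are the extra neighbours of x.
  module _ (v₁ x v₂ : Fin n) (L₁ S : Subset n) where
    InL₂ : Fin n → Set
    InL₂ w = w ≢ v₁ × w ≢ x × w ≢ v₂ × w ∉ L₁

    KEdge : Fin n → Fin n → Set
    KEdge u w = (u ≡ v₁ × w ∈ L₁) ⊎ (u ≡ x × InL₂ w) ⊎ (u ≡ v₂ × w ≡ v₁)
              ⊎ (u ≡ v₂ × w ≡ x) ⊎ (u ≡ x × w ∈ S)

    F₁Edges : Set
    F₁Edges = ∀ u w → Adj u w ⇔ (KEdge u w ⊎ KEdge w u)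

  InF₁ : Set
  InF₁ = Bipartite × ∃[ v₁ ] ∃[ x ] ∃[ v₂ ] ∃[ L₁ ] ∃[ S ]
    (v₁ ≢ x × v₁ ≢ v₂ × x ≢ v₂ ×
     v₁ ∉ L₁ × x ∉ L₁ × v₂ ∉ L₁ ×
     (∃[ w ] w ∈ L₁) × (∃[ w ] InL₂ v₁ x v₂ L₁ S w) ×
     S ⊆ L₁ × F₁Edges v₁ x v₂ L₁ S)

  InF₂ : Set
  InF₂ = ∃[ side ] (IsBipartition side × ∃[ v₁ ] ∃[ v₂ ] (InV₁ side v₁ × InV₂ side v₂ ×
    (∀ y → Adj v₁ y ⇔ InV₂ side y) × (∀ x → Adj v₂ x ⇔ InV₁ side x)))

  InF₃ : Set
  InF₃ = ∃[ side ] (IsBipartition side × ∃[ v₁ ] ∃[ v₂ ] (InV₁ side v₁ × InV₂ side v₂ ×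
    ¬ Adj v₁ v₂ ×
    (∀ y → Adj v₁ y ⇔ (InV₂ side y × y ≢ v₂)) ×
    (∀ x → Adj v₂ x ⇔ (InV₁ side x × x ≢ v₁))))

-- The lower bound holds because an edge needs two colours. A minimal dominating set is maximal
-- irredundant, so the identity colouring gives n colours; if u and v are non-adjacent, a minimal
-- dominating set avoiding v lets v share the colour of u, so χ_i(G) = n forces G = K_n.
-- The colour classes of a 2-colour irredundance colouring form a bipartition meeting a maximal
-- irredundant set R at most once per side. Unless G is a star, R = {a, b} with a ∈ V₁ and b ∈ V₂, and
-- maximality says that no third vertex w makes {a, b, w} irredundant. Unwinding this on each side
-- gives Property 𝔍₁ when ab is an edge and 𝔍₂ otherwise; a case analysis on the degrees of a and b
-- then sorts the graphs with these properties into F₁, F₂ and F₃.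

{-# OPTIONS --safe #-}
module Submission where

open import Defs
open import Data.Bool using (Bool; true; false; not)
import Data.Bool as Bool
open import Data.Bool.Properties using (not-injective; ¬-not)
open import Data.Empty using (⊥; ⊥-elim)
open import Data.Fin using (Fin; zero; suc; _≟_; toℕ; fromℕ<; punchOut)
open import Data.Fin.Properties
  using (2↔Bool; any?; all?; ¬∀⟶∃¬; toℕ<n; toℕ-fromℕ<; injective⇒≤; punchOut-injective)
open import Data.Fin.Subset using (Subset; _∈_; _∉_; _∪_; ⁅_⁆; _⊆_; _⊂_; ⊤; ∁; _-_)
open import Data.Fin.Subset.Induction using (⊂-wellFounded)
open import Data.Fin.Subset.Properties
  using (_∈?_; anySubset?; x∈⁅x⁆; x∈⁅y⁆⇒x≡y; x∈p∪q⁺; x∈p∪q⁻; ∈⊤; x∈p∧x≢y⇒x∈p-y; x∈p⇒p-x⊂p; x≢y⇒x∉⁅y⁆;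
         x∉p⇒x∈∁p; x∈∁p⇒x∉p)
open import Data.Nat using (ℕ; zero; suc; _≤_; _<_; z≤n; s≤s)
open import Data.Nat.Induction using (<-rec)
open import Data.Nat.Properties using (≮⇒≥; 1+n≰n)
open import Data.Product using (∃; ∃-syntax; _×_; _,_; proj₁; proj₂; map₂; uncurry)
open import Data.Product.Function.NonDependent.Propositional using (_×-⇔_)
open import Data.Sum as Sum using (_⊎_; inj₁; inj₂; [_,_])
open import Data.Vec using (tabulate)
import Data.Vec.Functional as Vector
open import Data.Vec.Properties using (lookup∘tabulate; []=⇒lookup; lookup⇒[]=)
open import Function using (_∘_)
open import Function.Bundles using (_⇔_; mk⇔; Equivalence; Inverse)
open import Function.Construct.Composition using (_⇔-∘_)
open import Function.Construct.Identity using (⇔-id)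
open import Function.Construct.Symmetry using (⇔-sym)
open import Induction.WellFounded using (module All)
open import Relation.Nullary using (¬_; Dec; yes; no; does)
open import Relation.Nullary.Decidable using (_×-dec_; _⊎-dec_; _→-dec_; ¬?; decidable-stable; dec-true)
open import Relation.Binary.PropositionalEquality
  using (_≡_; _≢_; refl; sym; trans; subst; cong; module ≡-Reasoning)

open Equivalence using (to; from)

any-function? : ∀ k {m} (P : (Fin k → Fin m) → Set) →
  (∀ {f g} → (∀ i → f i ≡ g i) → P f → P g) → (∀ f → Dec (P f)) → Dec (∃ P)
any-function? zero P resp P? with P? (λ ())
... | yes p = yes (_ , p)
... | no ¬p = no λ (f , pf) → ¬p (resp (λ ()) pf)
any-function? (suc k) P resp P?
  with any? (λ a → any-function? k (P ∘ (a Vector.∷_)) (λ e → resp λ { zero → refl ; (suc i) → e i })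
                                   (P? ∘ (a Vector.∷_)))
... | yes (a , g , p) = yes (_ , p)
... | no ¬p = no λ (f , pf) → ¬p (f zero , f ∘ suc , resp (λ { zero → refl ; (suc i) → refl }) pf)

least-witness : {P : ℕ → Set} → (∀ m → Dec (P m)) → ∀ n → P n → ∃[ k ] (P k × (∀ m → P m → k ≤ m))
least-witness {P} P? = <-rec _ search
  where
  search : ∀ n → (∀ {m} → m < n → P m → ∃[ k ] (P k × (∀ m → P m → k ≤ m))) →
           P n → ∃[ k ] (P k × (∀ m → P m → k ≤ m))
  search n below pn with any? (P? ∘ toℕ {n})
  ... | yes (i , pi) = below (toℕ<n i) pi
  ... | no none = n , pn , λ m pm → ≮⇒≥ λ m<n → none (fromℕ< m<n , subst P (sym (toℕ-fromℕ< m<n)) pm)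

module _ {m : ℕ} {P Q : Fin m → Set} (P? : ∀ z → Dec (P z)) (Q? : ∀ z → Dec (Q z)) where

  ⇒-or-counterexample : (∀ z → P z → Q z) ⊎ ∃[ z ] (P z × ¬ Q z)
  ⇒-or-counterexample with any? (λ z → P? z ×-dec ¬? (Q? z))
  ... | yes counterexample = inj₂ counterexample
  ... | no none = inj₁ λ z pz → decidable-stable (Q? z) λ ¬qz → none (z , pz , ¬qz)

module _ {m : ℕ} {P : Fin m → Set} (P? : ∀ x → Dec (P x)) where

  subset : Subset m
  subset = tabulate (does ∘ P?)

  ∈-subset⁺ : ∀ {x} → P x → x ∈ subset
  ∈-subset⁺ {x} px = lookup⇒[]= x subset (trans (lookup∘tabulate (does ∘ P?) x) (dec-true (P? x) px))

  ∈-subset⁻ : ∀ {x} → x ∈ subset → P x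
  ∈-subset⁻ {x} x∈ with P? x | trans (sym (lookup∘tabulate (does ∘ P?) x)) ([]=⇒lookup x∈)
  ... | yes px | _ = px

¬three-in-pair : ∀ {A : Set} {p q r α β : A} → p ≡ α ⊎ p ≡ β → q ≡ α ⊎ q ≡ β → r ≡ α ⊎ r ≡ β →
                 p ≢ q → p ≢ r → q ≢ r → ⊥
¬three-in-pair (inj₁ refl) (inj₁ refl) _ p≢q _ _ = p≢q refl
¬three-in-pair (inj₂ refl) (inj₂ refl) _ p≢q _ _ = p≢q refl
¬three-in-pair (inj₁ refl) (inj₂ refl) (inj₁ refl) _ p≢r _ = p≢r refl
¬three-in-pair (inj₁ refl) (inj₂ refl) (inj₂ refl) _ _ q≢r = q≢r refl
¬three-in-pair (inj₂ refl) (inj₁ refl) (inj₂ refl) _ p≢r _ = p≢r refl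
¬three-in-pair (inj₂ refl) (inj₁ refl) (inj₁ refl) _ _ q≢r = q≢r refl

-- Maximal irredundant sets and colourings

module _ {n : ℕ} (G : Graph n) where
  open Graph G using (E; irrefl) renaming (sym to E-sym)
  open ≡-Reasoning

  adj? : ∀ u v → Dec (Adj G u v)
  adj? u v = E u v Bool.≟ true

  Adj-sym : ∀ {u v} → Adj G u v → Adj G v u
  Adj-sym {u} {v} e = trans (E-sym v u) e

  Adj-irrefl : ∀ {v} → ¬ Adj G v v
  Adj-irrefl {v} e with trans (sym e) (irrefl v)
  ... | ()

  Adj⇒≢ : ∀ {u v} → Adj G u v → u ≢ v
  Adj⇒≢ e refl = Adj-irrefl e

  closedNbhd? : ∀ v w → Dec (InClosedNbhd G v w)
  closedNbhd? v w = (w ≟ v) ⊎-dec adj? v w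

  IrredundantOn : (Fin n → Set) → Set
  IrredundantOn P = ∀ v → P v → ∃[ w ] (InClosedNbhd G v w × (∀ u → P u → u ≢ v → ¬ InClosedNbhd G u w))

  IrredundantOn-resp : {P Q : Fin n → Set} → (∀ u → P u → Q u) → (∀ u → Q u → P u) →
                       IrredundantOn P → IrredundantOn Q
  IrredundantOn-resp pq qp irr v qv with irr v (qp v qv)
  ... | w , vw , unshared = w , vw , λ u qu u≢v → unshared u (qp u qu) u≢v

  irredundantOn? : (P : Fin n → Set) → (∀ u → Dec (P u)) → Dec (IrredundantOn P)
  irredundantOn? P P? = all? λ v → P? v →-dec any? λ w → closedNbhd? v w ×-dec
    all? λ u → P? u →-dec (¬? (u ≟ v) →-dec ¬? (closedNbhd? u w))

  irredundant? : ∀ S → Dec (Irredundant G S)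
  irredundant? S = irredundantOn? (_∈ S) (_∈? S)

  maximalIrredundant? : ∀ S → Dec (MaximalIrredundant G S)
  maximalIrredundant? S = irredundant? S ×-dec all? λ w → ¬? (w ∈? S) →-dec ¬? (irredundant? (S ∪ ⁅ w ⁆))

  properColoring? : ∀ {k} (c : Fin n → Fin k) → Dec (ProperColoring G c)
  properColoring? c = all? λ u → all? λ v → adj? u v →-dec ¬? (c u ≟ c v)

  irrColoring? : ∀ k c → Dec (IrrColoring G k c)
  irrColoring? k c = properColoring? c ×-dec anySubset? λ R → maximalIrredundant? R ×-dec
    all? λ u → all? λ v → u ∈? R →-dec (v ∈? R →-dec (¬? (u ≟ v) →-dec ¬? (c u ≟ c v)))

  IrrColoring-resp : ∀ {k} {c d : Fin n → Fin k} → (∀ i → c i ≡ d i) → IrrColoring G k c → IrrColoring G k d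
  IrrColoring-resp {c = c} {d} c≗d (proper , R , mir , rainbow) =
    (λ u v uv du≡dv → proper u v uv (transport u v du≡dv)) ,
    R , mir , λ u v u∈R v∈R u≢v du≡dv → rainbow u v u∈R v∈R u≢v (transport u v du≡dv)
    where
    transport : ∀ u v → d u ≡ d v → c u ≡ c v
    transport u v du≡dv = trans (c≗d u) (trans du≡dv (sym (c≗d v)))

  irrColorable? : ∀ k → Dec (IrrColorable G k)
  irrColorable? k = any-function? n (IrrColoring G k) IrrColoring-resp (irrColoring? k)

  Dominating : Subset n → Set
  Dominating S = ∀ v → ∃[ u ] (u ∈ S × InClosedNbhd G u v)

  dominating? : ∀ S → Dec (Dominating S)
  dominating? S = all? λ v → any? λ u → u ∈? S ×-dec closedNbhd? u v

  MinimalDominating : Subset n → Set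
  MinimalDominating S = Dominating S × (∀ v → v ∈ S → ¬ Dominating (S - v))

  -- A vertex whose removal destroys domination has a private neighbour; a new vertex never does.
  minimalDominating⇒maximalIrredundant : ∀ {S} → MinimalDominating S → MaximalIrredundant G S
  minimalDominating⇒maximalIrredundant {S} (dom , minimal) = irredundant , maximal
    where
    irredundant : Irredundant G S
    irredundant v v∈S with ¬∀⟶∃¬ n _ (λ x → any? λ u → u ∈? (S - v) ×-dec closedNbhd? u x) (minimal v v∈S)
    ... | x , undominated with dom x
    ... | u , u∈S , ux with u ≟ v
    ... | no u≢v = ⊥-elim (undominated (u , x∈p∧x≢y⇒x∈p-y u∈S u≢v , ux))
    ... | yes refl = x , ux , λ u′ u′∈S u′≢v u′x → undominated (u′ , x∈p∧x≢y⇒x∈p-y u′∈S u′≢v , u′x)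
    maximal : ∀ w → w ∉ S → ¬ Irredundant G (S ∪ ⁅ w ⁆)
    maximal w w∉S irr with irr w (x∈p∪q⁺ (inj₂ (x∈⁅x⁆ w)))
    ... | p , _ , unshared with dom p
    ... | u , u∈S , up = unshared u (x∈p∪q⁺ (inj₁ u∈S)) (λ { refl → w∉S u∈S }) up

  minimalDominating-⊆ : ∀ {S} → Dominating S → ∃[ R ] (R ⊆ S × MinimalDominating R)
  minimalDominating-⊆ {S} = All.wfRec ⊂-wellFounded _ _ shrink S
    where
    shrink : ∀ S → (∀ {T} → T ⊂ S → Dominating T → ∃[ R ] (R ⊆ T × MinimalDominating R)) →
             Dominating S → ∃[ R ] (R ⊆ S × MinimalDominating R)
    shrink S smaller dom with any? (λ v → v ∈? S ×-dec dominating? (S - v))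
    ... | yes (v , v∈S , dom′) with smaller (x∈p⇒p-x⊂p v∈S) dom′
    ...   | R , R⊆S-v , minimal = R , (λ x∈R → proj₁ (x∈p⇒p-x⊂p v∈S) (R⊆S-v x∈R)) , minimal
    shrink S smaller dom | no none = S , (λ x∈S → x∈S) , dom , λ v v∈S dom′ → none (v , v∈S , dom′)

  maximalIrredundant-⊆ : ∀ {S} → Dominating S → ∃[ R ] (R ⊆ S × MaximalIrredundant G R)
  maximalIrredundant-⊆ dom = map₂ (map₂ minimalDominating⇒maximalIrredundant) (minimalDominating-⊆ dom)

  ∃-maximalIrredundant : ∃[ R ] MaximalIrredundant G R
  ∃-maximalIrredundant = map₂ proj₂ (maximalIrredundant-⊆ {⊤} λ v → v , ∈⊤ , inj₁ refl)

  ∃-maximalIrredundant-∌ : NoIsolated G → ∀ v → ∃[ R ] (MaximalIrredundant G R × v ∉ R)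
  ∃-maximalIrredundant-∌ noIsolated v =
    map₂ (λ (R⊆∁v , mir) → mir , λ v∈R → x∈∁p⇒x∉p (R⊆∁v v∈R) (x∈⁅x⁆ v)) (maximalIrredundant-⊆ dom)
    where
    dom : Dominating (∁ ⁅ v ⁆)
    dom x with x ≟ v | noIsolated x
    ... | no x≢v | _ = x , x∉p⇒x∈∁p (x≢y⇒x∉⁅y⁆ x≢v) , inj₁ refl
    ... | yes refl | w , xw = w , x∉p⇒x∈∁p (x≢y⇒x∉⁅y⁆ (Adj⇒≢ (Adj-sym xw))) , inj₂ (Adj-sym xw)

  2≤colours : ∀ {k} {c : Fin n → Fin k} {u v} → ProperColoring G c → Adj G u v → 2 ≤ k
  2≤colours {zero}        {c} {u}     _      _  with c u
  ... | ()
  2≤colours {suc zero}    {c} {u} {v} proper uv with c u | c v | proper u v uv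
  ... | zero | zero | cu≢cv = ⊥-elim (cu≢cv refl)
  2≤colours {suc (suc k)} _ _ = s≤s (s≤s z≤n)

  irrColorable-n : IrrColorable G n
  irrColorable-n = let R , mir = ∃-maximalIrredundant in
    (λ v → v) , (λ u v uv → Adj⇒≢ uv) , R , mir , λ u v _ _ u≢v → u≢v

  complete⇒n≤colours : Complete G → ∀ {k} → IrrColorable G k → n ≤ k
  complete⇒n≤colours complete (c , proper , _) = injective⇒≤ c-injective
    where
    c-injective : ∀ {u v} → c u ≡ c v → u ≡ v
    c-injective {u} {v} cu≡cv with u ≟ v
    ... | yes u≡v = u≡v
    ... | no u≢v = ⊥-elim (proper u v (complete u v u≢v) cu≡cv)

  bipartition⇒irrColorable-2 : ∀ {side R} → IsBipartition G side → MaximalIrredundant G R →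
    (∀ u v → u ∈ R → v ∈ R → u ≢ v → side u ≢ side v) → IrrColorable G 2
  bipartition⇒irrColorable-2 {side} {R} bip mir R-split =
    colour , (λ u v uv → bip u v uv ∘ colour-injective) ,
    R , mir , λ u v u∈R v∈R u≢v → R-split u v u∈R v∈R u≢v ∘ colour-injective
    where
    colour : Fin n → Fin 2
    colour = Inverse.from 2↔Bool ∘ side
    colour-injective : ∀ {u v} → colour u ≡ colour v → side u ≡ side v
    colour-injective {u} {v} cu≡cv = begin
      side u                          ≡⟨ Inverse.strictlyInverseˡ 2↔Bool (side u) ⟨
      Inverse.to 2↔Bool (colour u)    ≡⟨ cong (Inverse.to 2↔Bool) cu≡cv ⟩
      Inverse.to 2↔Bool (colour v)    ≡⟨ Inverse.strictlyInverseˡ 2↔Bool (side v) ⟩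
      side v                          ∎

  IrrColorable⇒2≤ : NoIsolated G → Fin n → ∀ {k} → IrrColorable G k → 2 ≤ k
  IrrColorable⇒2≤ noIsolated v (_ , proper , _) = 2≤colours proper (proj₂ (noIsolated v))

  irrColorable-2⇒χ≡2 : NoIsolated G → Fin n → IrrColorable G 2 → IsChiI G 2
  irrColorable-2⇒χ≡2 noIsolated v colourable = colourable , λ m → IrrColorable⇒2≤ noIsolated v

  star⇒χ≡2 : NoIsolated G → IsStar G → IsChiI G 2
  star⇒χ≡2 noIsolated (centre , centre-adj , edge-at-centre) =
    irrColorable-2⇒χ≡2 noIsolated centre
      (bipartition⇒irrColorable-2 {side} bip (irredundant , maximal) λ u v u∈ v∈ u≢v _ → u≢v (unique u∈ v∈))
    where
    side : Fin n → Bool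
    side w = does (w ≟ centre)
    side-true : ∀ {w} → side w ≡ true → w ≡ centre
    side-true {w} with w ≟ centre
    ... | yes w≡c = λ _ → w≡c
    ... | no _ = λ ()
    bip : IsBipartition G side
    bip u v uv su≡sv with edge-at-centre u v uv
    ... | inj₁ refl = Adj⇒≢ uv (sym (side-true (trans (sym su≡sv) (dec-true (u ≟ u) refl))))
    ... | inj₂ refl = Adj⇒≢ uv (side-true (trans su≡sv (dec-true (v ≟ v) refl)))
    unique : ∀ {u v} → u ∈ ⁅ centre ⁆ → v ∈ ⁅ centre ⁆ → u ≡ v
    unique u∈ v∈ = trans (x∈⁅y⁆⇒x≡y centre u∈) (sym (x∈⁅y⁆⇒x≡y centre v∈))
    irredundant : Irredundant G ⁅ centre ⁆
    irredundant v v∈ = v , inj₁ refl , λ u u∈ u≢v _ → u≢v (unique u∈ v∈)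
    maximal : ∀ w → w ∉ ⁅ centre ⁆ → ¬ Irredundant G (⁅ centre ⁆ ∪ ⁅ w ⁆)
    maximal w w∉ irr with irr w (x∈p∪q⁺ (inj₂ (x∈⁅x⁆ w)))
    ... | p , _ , unshared = unshared centre (x∈p∪q⁺ (inj₁ (x∈⁅x⁆ centre))) (λ { refl → w∉ (x∈⁅x⁆ w) }) centre-p
      where
      centre-p : InClosedNbhd G centre p
      centre-p with p ≟ centre
      ... | yes p≡c = inj₁ p≡c
      ... | no p≢c = inj₂ (centre-adj p p≢c)

  -- Maximal irredundant pairs

  HasPrivate : Fin n → Fin n → Set
  HasPrivate a b = ∃[ p ] (InClosedNbhd G a p × ¬ InClosedNbhd G b p)

  HasPrivate₂ : Fin n → Fin n → Fin n → Set
  HasPrivate₂ a b c = ∃[ p ] (InClosedNbhd G a p × ¬ InClosedNbhd G b p × ¬ InClosedNbhd G c p)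

  HasPrivate₂-swap : ∀ {a b c} → HasPrivate₂ a b c → HasPrivate₂ a c b
  HasPrivate₂-swap (p , ap , ¬bp , ¬cp) = p , ap , ¬cp , ¬bp

  IrredundantTriple : Fin n → Fin n → Fin n → Set
  IrredundantTriple a b c = HasPrivate₂ a b c × HasPrivate₂ b a c × HasPrivate₂ c a b

  MaximalPair : Fin n → Fin n → Set
  MaximalPair a b = ∀ w → w ≢ a → w ≢ b → ¬ IrredundantTriple a b w

  MaximalPair-sym : ∀ {a b} → MaximalPair a b → MaximalPair b a
  MaximalPair-sym maximal w w≢b w≢a (pb , pa , pw) = maximal w w≢a w≢b (pa , pb , HasPrivate₂-swap pw)

  private⇒adj : ∀ {a b p} → Adj G b a → InClosedNbhd G a p → ¬ InClosedNbhd G b p → Adj G a p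
  private⇒adj ba (inj₁ refl) ¬bp = ⊥-elim (¬bp (inj₂ ba))
  private⇒adj ba (inj₂ ap) ¬bp = ap

  ∉N[]⇒≢ : ∀ {b p} → ¬ InClosedNbhd G b p → p ≢ b
  ∉N[]⇒≢ ¬bp p≡b = ¬bp (inj₁ p≡b)

  ∉N[]⇒¬adj : ∀ {b p} → ¬ InClosedNbhd G b p → ¬ Adj G b p
  ∉N[]⇒¬adj ¬bp bp = ¬bp (inj₂ bp)

  ∉N[] : ∀ {v u} → u ≢ v → ¬ Adj G v u → ¬ InClosedNbhd G v u
  ∉N[] u≢v ¬vu = [ u≢v , ¬vu ]

  irredundantOn-pair : ∀ {a b} → HasPrivate a b → HasPrivate b a → IrredundantOn (λ t → t ≡ a ⊎ t ≡ b)
  irredundantOn-pair (p , ap , ¬bp) _ v (inj₁ refl) =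
    p , ap , λ { u (inj₁ refl) u≢v → ⊥-elim (u≢v refl) ; u (inj₂ refl) _ → ¬bp }
  irredundantOn-pair _ (q , bq , ¬aq) v (inj₂ refl) =
    q , bq , λ { u (inj₁ refl) _ → ¬aq ; u (inj₂ refl) u≢v → ⊥-elim (u≢v refl) }

  irredundantOn-triple : ∀ {a b c} → IrredundantTriple a b c → IrredundantOn (λ t → t ≡ a ⊎ t ≡ b ⊎ t ≡ c)
  irredundantOn-triple ((p , ap , ¬bp , ¬cp) , _ , _) v (inj₁ refl) = p , ap ,
    λ { u (inj₁ refl) u≢v → ⊥-elim (u≢v refl) ; u (inj₂ (inj₁ refl)) _ → ¬bp ; u (inj₂ (inj₂ refl)) _ → ¬cp }
  irredundantOn-triple (_ , (p , bp , ¬ap , ¬cp) , _) v (inj₂ (inj₁ refl)) = p , bp ,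
    λ { u (inj₁ refl) _ → ¬ap ; u (inj₂ (inj₁ refl)) u≢v → ⊥-elim (u≢v refl) ; u (inj₂ (inj₂ refl)) _ → ¬cp }
  irredundantOn-triple (_ , _ , (p , cp , ¬ap , ¬bp)) v (inj₂ (inj₂ refl)) = p , cp ,
    λ { u (inj₁ refl) _ → ¬ap ; u (inj₂ (inj₁ refl)) _ → ¬bp ; u (inj₂ (inj₂ refl)) u≢v → ⊥-elim (u≢v refl) }

  irredundant⇒HasPrivate₂ : ∀ {S a b c} → Irredundant G S → a ∈ S → b ∈ S → c ∈ S → b ≢ a → c ≢ a →
                            HasPrivate₂ a b c
  irredundant⇒HasPrivate₂ irr a∈S b∈S c∈S b≢a c≢a with irr _ a∈S
  ... | p , ap , unshared = p , ap , unshared _ b∈S b≢a , unshared _ c∈S c≢a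

  module _ {R : Subset n} {a b : Fin n} (a∈R : a ∈ R) (b∈R : b ∈ R) (a≢b : a ≢ b)
           (R⊆ab : ∀ t → t ∈ R → t ≡ a ⊎ t ≡ b) where

    R∪w⇒abw : ∀ {w} t → t ∈ R ∪ ⁅ w ⁆ → t ≡ a ⊎ t ≡ b ⊎ t ≡ w
    R∪w⇒abw {w} t t∈ with x∈p∪q⁻ R ⁅ w ⁆ t∈
    ... | inj₂ t∈w = inj₂ (inj₂ (x∈⁅y⁆⇒x≡y w t∈w))
    ... | inj₁ t∈R with R⊆ab t t∈R
    ...   | inj₁ t≡a = inj₁ t≡a
    ...   | inj₂ t≡b = inj₂ (inj₁ t≡b)

    abw⇒R∪w : ∀ {w} t → t ≡ a ⊎ t ≡ b ⊎ t ≡ w → t ∈ R ∪ ⁅ w ⁆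
    abw⇒R∪w t (inj₁ refl) = x∈p∪q⁺ (inj₁ a∈R)
    abw⇒R∪w t (inj₂ (inj₁ refl)) = x∈p∪q⁺ (inj₁ b∈R)
    abw⇒R∪w t (inj₂ (inj₂ refl)) = x∈p∪q⁺ (inj₂ (x∈⁅x⁆ t))

    maximalIrredundant-pair⁻ : MaximalIrredundant G R → HasPrivate a b × HasPrivate b a × MaximalPair a b
    maximalIrredundant-pair⁻ (irr , maximal) = private-a , private-b , maximalPair
      where
      private-a : HasPrivate a b
      private-a with irr a a∈R
      ... | p , ap , unshared = p , ap , unshared b b∈R (a≢b ∘ sym)
      private-b : HasPrivate b a
      private-b with irr b b∈R
      ... | p , bp , unshared = p , bp , unshared a a∈R a≢b
      maximalPair : MaximalPair a b
      maximalPair w w≢a w≢b triple = maximal w w∉R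
        (IrredundantOn-resp abw⇒R∪w R∪w⇒abw (irredundantOn-triple triple))
        where
        w∉R : w ∉ R
        w∉R w∈R = [ w≢a , w≢b ] (R⊆ab w w∈R)

    maximalIrredundant-pair⁺ : HasPrivate a b → HasPrivate b a → MaximalPair a b → MaximalIrredundant G R
    maximalIrredundant-pair⁺ private-a private-b maximalPair = irredundant , maximal
      where
      irredundant : Irredundant G R
      irredundant = IrredundantOn-resp (λ { t (inj₁ refl) → a∈R ; t (inj₂ refl) → b∈R }) R⊆ab
                      (irredundantOn-pair private-a private-b)
      maximal : ∀ w → w ∉ R → ¬ Irredundant G (R ∪ ⁅ w ⁆)
      maximal w w∉R irr = maximalPair w w≢a w≢b
        ( irredundant⇒HasPrivate₂ irr a∈ b∈ w∈ (a≢b ∘ sym) w≢a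
        , irredundant⇒HasPrivate₂ irr b∈ a∈ w∈ a≢b w≢b
        , irredundant⇒HasPrivate₂ irr w∈ a∈ b∈ (w≢a ∘ sym) (w≢b ∘ sym) )
        where
        w≢a : w ≢ a
        w≢a refl = w∉R a∈R
        w≢b : w ≢ b
        w≢b refl = w∉R b∈R
        a∈ : a ∈ R ∪ ⁅ w ⁆
        a∈ = x∈p∪q⁺ (inj₁ a∈R)
        b∈ : b ∈ R ∪ ⁅ w ⁆
        b∈ = x∈p∪q⁺ (inj₁ b∈R)
        w∈ : w ∈ R ∪ ⁅ w ⁆
        w∈ = x∈p∪q⁺ (inj₂ (x∈⁅x⁆ w))

  maximalIrredundant-singleton⇒universal : ∀ {R v} → v ∈ R → (∀ t → t ∈ R → t ≡ v) →
    MaximalIrredundant G R → ∀ w → w ≢ v → Adj G v w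
  maximalIrredundant-singleton⇒universal {R} {v} v∈R R⊆v (_ , maximal) w w≢v with adj? v w
  ... | yes vw = vw
  ... | no ¬vw = ⊥-elim (maximal w (w≢v ∘ R⊆v w) (IrredundantOn-resp vw⇒R∪w R∪w⇒vw
                   (irredundantOn-pair private-v private-w)))
    where
    private-v : HasPrivate v w
    private-v = v , inj₁ refl , λ { (inj₁ v≡w) → w≢v (sym v≡w) ; (inj₂ wv) → ¬vw (Adj-sym wv) }
    private-w : HasPrivate w v
    private-w = w , inj₁ refl , λ { (inj₁ w≡v) → w≢v w≡v ; (inj₂ vw) → ¬vw vw }
    vw⇒R∪w : ∀ t → t ≡ v ⊎ t ≡ w → t ∈ R ∪ ⁅ w ⁆
    vw⇒R∪w t (inj₁ refl) = x∈p∪q⁺ (inj₁ v∈R)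
    vw⇒R∪w t (inj₂ refl) = x∈p∪q⁺ (inj₂ (x∈⁅x⁆ w))
    R∪w⇒vw : ∀ t → t ∈ R ∪ ⁅ w ⁆ → t ≡ v ⊎ t ≡ w
    R∪w⇒vw t t∈ = Sum.map (R⊆v t) (x∈⁅y⁆⇒x≡y w) (x∈p∪q⁻ R ⁅ w ⁆ t∈)

  maximalIrredundant-nonempty : ∀ {R} → Fin n → MaximalIrredundant G R → ∃[ v ] v ∈ R
  maximalIrredundant-nonempty {R} v (_ , maximal) with any? (_∈? R)
  ... | yes nonempty = nonempty
  ... | no empty = ⊥-elim (maximal v (λ v∈R → empty (v , v∈R))
          (IrredundantOn-resp (λ { t refl → x∈p∪q⁺ (inj₂ (x∈⁅x⁆ v)) }) R∪v⇒v singleton-irredundant))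
    where
    singleton-irredundant : IrredundantOn (_≡ v)
    singleton-irredundant v refl = v , inj₁ refl , λ { u refl u≢v → ⊥-elim (u≢v refl) }
    R∪v⇒v : ∀ t → t ∈ R ∪ ⁅ v ⁆ → t ≡ v
    R∪v⇒v t t∈ = [ (λ t∈R → ⊥-elim (empty (t , t∈R))) , x∈⁅y⁆⇒x≡y v ] (x∈p∪q⁻ R ⁅ v ⁆ t∈)

  deg≥2⇒neighbour-≢ : ∀ {x} → Deg≥2 G x → ∀ y → ∃[ s ] (Adj G x s × s ≢ y)
  deg≥2⇒neighbour-≢ (p , q , p≢q , xp , xq) y with p ≟ y
  ... | no p≢y = p , xp , p≢y
  ... | yes refl = q , xq , p≢q ∘ sym

  deg≥3⇒neighbour-≢₂ : ∀ {a} → Deg≥3 G a → ∀ b x → ∃[ t ] (Adj G a t × t ≢ b × t ≢ x)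
  deg≥3⇒neighbour-≢₂ (p , q , r , p≢q , p≢r , q≢r , ap , aq , ar) b x with p ≟ b | p ≟ x
  ... | no p≢b | no p≢x = p , ap , p≢b , p≢x
  ... | yes refl | _ with q ≟ x
  ...   | no q≢x = q , aq , p≢q ∘ sym , q≢x
  ...   | yes refl = r , ar , p≢r ∘ sym , q≢r ∘ sym
  deg≥3⇒neighbour-≢₂ (p , q , r , p≢q , p≢r , q≢r , ap , aq , ar) b x | no _ | yes refl with q ≟ b
  ...   | no q≢b = q , aq , q≢b , p≢q ∘ sym
  ...   | yes refl = r , ar , q≢r ∘ sym , p≢r ∘ sym

  deg≥3? : ∀ a → Dec (Deg≥3 G a)
  deg≥3? a = any? λ p → any? λ q → any? λ r → ¬? (p ≟ q) ×-dec ¬? (p ≟ r) ×-dec ¬? (q ≟ r) ×-dec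
    adj? a p ×-dec adj? a q ×-dec adj? a r

  ¬deg≥3⇒neighbour-unique : ∀ {a b t} → ¬ Deg≥3 G a → Adj G a b → Adj G a t → t ≢ b →
                            ∀ y → Adj G a y → y ≢ b → y ≡ t
  ¬deg≥3⇒neighbour-unique {t = t} ¬deg ab at t≢b y ay y≢b with y ≟ t
  ... | yes y≡t = y≡t
  ... | no y≢t = ⊥-elim (¬deg (_ , _ , _ , t≢b ∘ sym , y≢b ∘ sym , y≢t ∘ sym , ab , at , ay))

  -- Bipartitions and the properties 𝔍₁, 𝔍₂

  opposite : (Fin n → Bool) → Fin n → Bool
  opposite side = not ∘ side

  IsBipartition-opposite : ∀ {side} → IsBipartition G side → IsBipartition G (opposite side)
  IsBipartition-opposite bip u v uv = bip u v uv ∘ not-injective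

  not-⇔ : ∀ {s b} → (s ≡ b) ⇔ (not s ≡ not b)
  not-⇔ = mk⇔ (cong not) not-injective

  opposite-⇔ : ∀ {A C : Set} {s} b → A ⇔ (s ≡ b × C) → A ⇔ (not s ≡ not b × C)
  opposite-⇔ b e = (not-⇔ ×-⇔ ⇔-id _) ⇔-∘ e

  opposite-⇔⁻ : ∀ {A C : Set} {s} b → A ⇔ (not s ≡ not b × C) → A ⇔ (s ≡ b × C)
  opposite-⇔⁻ b e = (⇔-sym not-⇔ ×-⇔ ⇔-id _) ⇔-∘ e

  CondC-opposite : ∀ {side vi vj} b → CondC G side vi vj b → CondC G (opposite side) vi vj (not b)
  CondC-opposite b cond deg x vix = Sum.map₂ (Sum.map₂ λ N≡V z → not-⇔ ⇔-∘ N≡V z) (cond deg x vix)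

  CondC-opposite⁻ : ∀ {side vi vj} b → CondC G (opposite side) vi vj (not b) → CondC G side vi vj b
  CondC-opposite⁻ b cond deg x vix = Sum.map₂ (Sum.map₂ λ N≡V z → ⇔-sym not-⇔ ⇔-∘ N≡V z) (cond deg x vix)

  𝔍₁At : (Fin n → Bool) → Fin n → Fin n → Set
  𝔍₁At side v₁ v₂ = InV₁ G side v₁ × InV₂ G side v₂ × Adj G v₁ v₂ × Deg≥2 G v₁ × Deg≥2 G v₂ ×
    (∀ y → InV₂ G side y → ¬ Adj G v₁ y → ∀ x → Adj G v₂ x → x ≢ v₁ → Adj G y x) ×
    (∀ x → InV₁ G side x → ¬ Adj G v₂ x → ∀ y → Adj G v₁ y → y ≢ v₂ → Adj G x y) ×
    CondC G side v₁ v₂ true × CondC G side v₂ v₁ false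

  𝔍₂At : (Fin n → Bool) → Fin n → Fin n → Set
  𝔍₂At side v₁ v₂ = InV₁ G side v₁ × InV₂ G side v₂ × ¬ Adj G v₁ v₂ ×
    (∀ y → Adj G v₁ y ⇔ (InV₂ G side y × y ≢ v₂)) ×
    (∀ x → Adj G v₂ x ⇔ (InV₁ G side x × x ≢ v₁))

  𝔍₁At-opposite : ∀ {side a b} → 𝔍₁At side a b → 𝔍₁At (opposite side) b a
  𝔍₁At-opposite (a∈V₁ , b∈V₂ , ab , deg-a , deg-b , cond-a , cond-b , cond-c-a , cond-c-b) =
    cong not b∈V₂ , cong not a∈V₁ , Adj-sym ab , deg-b , deg-a ,
    (λ y y∈ → cond-b y (not-injective y∈)) , (λ x x∈ → cond-a x (not-injective x∈)) ,
    CondC-opposite false cond-c-b , CondC-opposite true cond-c-a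

  V₁-V₂⇒side≢ : ∀ side {u v} → InV₁ G side u → InV₂ G side v → side u ≢ side v
  V₁-V₂⇒side≢ side u∈V₁ v∈V₂ su≡sv with trans (sym u∈V₁) (trans su≡sv v∈V₂)
  ... | ()

  SplitMaximalPair : (Fin n → Bool) → Fin n → Fin n → Set
  SplitMaximalPair side a b = InV₁ G side a × InV₂ G side b × HasPrivate a b × HasPrivate b a × MaximalPair a b

  module _ (side : Fin n → Bool) (bip : IsBipartition G side) where

    Adj⇒opposite-sides : ∀ {u v} → Adj G u v → side v ≡ not (side u)
    Adj⇒opposite-sides {u} {v} uv with side u | side v | bip u v uv
    ... | true  | false | _ = refl
    ... | false | true  | _ = refl
    ... | true  | true  | ≢ = ⊥-elim (≢ refl)
    ... | false | false | ≢ = ⊥-elim (≢ refl)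

    Adj-V₁⇒V₂ : ∀ {u v} → Adj G u v → InV₁ G side u → InV₂ G side v
    Adj-V₁⇒V₂ uv u∈V₁ = trans (Adj⇒opposite-sides uv) (cong not u∈V₁)

    Adj-V₂⇒V₁ : ∀ {u v} → Adj G u v → InV₂ G side u → InV₁ G side v
    Adj-V₂⇒V₁ uv u∈V₂ = trans (Adj⇒opposite-sides uv) (cong not u∈V₂)

    same-side⇒¬Adj : ∀ {u v} → side u ≡ side v → ¬ Adj G u v
    same-side⇒¬Adj su≡sv uv = bip _ _ uv su≡sv

    V₁-V₂⇒≢ : ∀ {u v} → InV₁ G side u → InV₂ G side v → u ≢ v
    V₁-V₂⇒≢ u∈V₁ v∈V₂ refl = V₁-V₂⇒side≢ side u∈V₁ v∈V₂ refl

    module _ {a b : Fin n} (a∈V₁ : InV₁ G side a) (b∈V₂ : InV₂ G side b) where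

      V₂∉N[b] : ∀ {y} → InV₂ G side y → y ≢ b → ¬ InClosedNbhd G b y
      V₂∉N[b] y∈V₂ y≢b = ∉N[] y≢b (same-side⇒¬Adj (trans b∈V₂ (sym y∈V₂)))

      V₁∉N[a] : ∀ {x} → InV₁ G side x → x ≢ a → ¬ InClosedNbhd G a x
      V₁∉N[a] x∈V₁ x≢a = ∉N[] x≢a (same-side⇒¬Adj (trans a∈V₁ (sym x∈V₁)))

      -- If x ∈ V₁ missed both b and some y ∈ N(a) ∖ {b}, then y, a private neighbour of b,
      -- and x itself would make {a, b, x} irredundant.
      maximalPair⇒𝔍₁-b : Adj G a b → HasPrivate b a → MaximalPair a b →
        ∀ x → InV₁ G side x → ¬ Adj G b x → ∀ y → Adj G a y → y ≢ b → Adj G x y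
      maximalPair⇒𝔍₁-b ab (q , b-q , ¬aq) maximal x x∈V₁ ¬bx y ay y≢b with adj? x y
      ... | yes xy = xy
      ... | no ¬xy = ⊥-elim (maximal x x≢a (V₁-V₂⇒≢ x∈V₁ b∈V₂) (private-a , private-b , private-x))
        where
        x≢a : x ≢ a
        x≢a refl = ¬bx (Adj-sym ab)
        y∈V₂ : InV₂ G side y
        y∈V₂ = Adj-V₁⇒V₂ ay a∈V₁
        bq : Adj G b q
        bq = private⇒adj ab b-q ¬aq
        private-a : HasPrivate₂ a b x
        private-a = y , inj₂ ay , V₂∉N[b] y∈V₂ y≢b , ∉N[] (V₁-V₂⇒≢ x∈V₁ y∈V₂ ∘ sym) ¬xy
        private-b : HasPrivate₂ b a x
        private-b = q , inj₂ bq , ¬aq ,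
          λ { (inj₁ refl) → ¬bx bq ; (inj₂ xq) → same-side⇒¬Adj (trans x∈V₁ (sym (Adj-V₂⇒V₁ bq b∈V₂))) xq }
        private-x : HasPrivate₂ x a b
        private-x = x , inj₁ refl , V₁∉N[a] x∈V₁ x≢a , ∉N[] (V₁-V₂⇒≢ x∈V₁ b∈V₂) ¬bx

      N[b]∖a⊆N⇒V₁⊆N : Adj G a b → HasPrivate b a → MaximalPair a b → ∀ {x} → Adj G a x → x ≢ b →
        (∀ y → Adj G b y × y ≢ a → Adj G x y) → ∀ w → InV₁ G side w → Adj G x w
      N[b]∖a⊆N⇒V₁⊆N ab private-b maximal {x} ax x≢b N[b]∖a⊆N[x] w w∈V₁ with adj? b w | w ≟ a
      ... | no ¬bw | _ = Adj-sym (maximalPair⇒𝔍₁-b ab private-b maximal w w∈V₁ ¬bw x ax x≢b)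
      ... | yes _ | yes refl = Adj-sym ax
      ... | yes bw | no w≢a = N[b]∖a⊆N[x] w (bw , w≢a)

      irredundantTriple-in-N[a] : ∀ {x t y z} → Adj G a b → Adj G a x → x ≢ b →
        Adj G a t → t ≢ b → t ≢ x → Adj G b y → y ≢ a → ¬ Adj G x y → Adj G x z → ¬ Adj G b z →
        IrredundantTriple a b x
      irredundantTriple-in-N[a] {x} {t} {y} {z} ab ax x≢b at t≢b t≢x by y≢a ¬xy xz ¬bz =
        (t , inj₂ at , ∉N[] t≢b (same-side⇒¬Adj (trans b∈V₂ (sym t∈V₂))) ,
               ∉N[] t≢x (same-side⇒¬Adj (trans x∈V₂ (sym t∈V₂)))) ,
        (y , inj₂ by , V₁∉N[a] y∈V₁ y≢a , ∉N[] (V₁-V₂⇒≢ y∈V₁ x∈V₂) ¬xy) ,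
        (z , inj₂ xz , ∉N[] (λ { refl → ¬bz (Adj-sym ab) }) (same-side⇒¬Adj (trans a∈V₁ (sym z∈V₁))) ,
               ∉N[] (V₁-V₂⇒≢ z∈V₁ b∈V₂) ¬bz)
        where
        x∈V₂ : InV₂ G side x
        x∈V₂ = Adj-V₁⇒V₂ ax a∈V₁
        t∈V₂ : InV₂ G side t
        t∈V₂ = Adj-V₁⇒V₂ at a∈V₁
        y∈V₁ : InV₁ G side y
        y∈V₁ = Adj-V₂⇒V₁ by b∈V₂
        z∈V₁ : InV₁ G side z
        z∈V₁ = Adj-V₂⇒V₁ xz x∈V₂

      maximalPair⇒𝔍₁-c : Adj G a b → HasPrivate b a → MaximalPair a b → CondC G side a b true
      maximalPair⇒𝔍₁-c ab private-b maximal deg-a x ax with x ≟ b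
      ... | yes refl = inj₂ (inj₁ λ z bz → bz)
      ... | no x≢b with ⇒-or-counterexample (adj? x) (adj? b)
      ...   | inj₁ N[x]⊆N[b] = inj₂ (inj₁ N[x]⊆N[b])
      ...   | inj₂ (z , xz , ¬bz) with ⇒-or-counterexample (λ y → adj? b y ×-dec ¬? (y ≟ a)) (adj? x)
      ...     | inj₁ N[b]∖a⊆N[x] = inj₂ (inj₂ λ w →
                  mk⇔ (λ xw → Adj-V₂⇒V₁ xw (Adj-V₁⇒V₂ ax a∈V₁)) (N[b]∖a⊆N⇒V₁⊆N ab private-b maximal ax x≢b N[b]∖a⊆N[x] w))
      ...     | inj₂ (y , (by , y≢a) , ¬xy) with deg≥3⇒neighbour-≢₂ deg-a b x
      ...       | t , at , t≢b , t≢x = ⊥-elim (maximal x (Adj⇒≢ ax ∘ sym) x≢b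
                    (irredundantTriple-in-N[a] ab ax x≢b at t≢b t≢x by y≢a ¬xy xz ¬bz))

      -- Nonadjacent a and b are their own private neighbours, and so is any y ∈ V₂ ∖ (N(a) ∪ {b}).
      maximalPair⇒𝔍₂-N : ¬ Adj G a b → MaximalPair a b → ∀ y → Adj G a y ⇔ (InV₂ G side y × y ≢ b)
      maximalPair⇒𝔍₂-N ¬ab maximal y = mk⇔ (λ ay → Adj-V₁⇒V₂ ay a∈V₁ , λ { refl → ¬ab ay }) V₂∖b⊆N[a]
        where
        V₂∖b⊆N[a] : InV₂ G side y × y ≢ b → Adj G a y
        V₂∖b⊆N[a] (y∈V₂ , y≢b) with adj? a y
        ... | yes ay = ay
        ... | no ¬ay = ⊥-elim (maximal y (V₁-V₂⇒≢ a∈V₁ y∈V₂ ∘ sym) y≢b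
                (private-a , private-b , (y , inj₁ refl , ∉N[] (V₁-V₂⇒≢ a∈V₁ y∈V₂ ∘ sym) ¬ay , V₂∉N[b] y∈V₂ y≢b)))
          where
          private-a : HasPrivate₂ a b y
          private-a = a , inj₁ refl , ∉N[] a≢b (¬ab ∘ Adj-sym) , ∉N[] (V₁-V₂⇒≢ a∈V₁ y∈V₂) (¬ay ∘ Adj-sym)
            where
            a≢b : a ≢ b
            a≢b = V₁-V₂⇒≢ a∈V₁ b∈V₂
          private-b : HasPrivate₂ b a y
          private-b = b , inj₁ refl , ∉N[] (V₁-V₂⇒≢ a∈V₁ b∈V₂ ∘ sym) ¬ab , ∉N[] (y≢b ∘ sym) (same-side⇒¬Adj (trans y∈V₂ (sym b∈V₂)))

      -- If w ∉ N(b), condition (b) joins w to the private neighbour of a; otherwise deg b ≥ 3 and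
      -- condition (c) at b rules out every possible neighbourhood of w.
      𝔍₁⇒no-triple-in-V₁ : Adj G a b →
        (∀ x → InV₁ G side x → ¬ Adj G b x → ∀ y → Adj G a y → y ≢ b → Adj G x y) →
        CondC G side b a false → ∀ w → InV₁ G side w → w ≢ a → w ≢ b → ¬ IrredundantTriple a b w
      𝔍₁⇒no-triple-in-V₁ ab cond-b cond-c-b w w∈V₁ w≢a w≢b
        ((r , a-r , ¬br , ¬wr) , (p , b-p , ¬ap , ¬wp) , (q , w-q , ¬aq , ¬bq)) with adj? b w
      ... | no ¬bw = ∉N[]⇒¬adj ¬wr (cond-b w w∈V₁ ¬bw r ar (∉N[]⇒≢ ¬br))
        where
        ar : Adj G a r
        ar = private⇒adj (Adj-sym ab) a-r ¬br
      ... | yes bw with cond-c-b deg-b w bw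
        where
        deg-b : Deg≥3 G b
        deg-b = a , w , p , w≢a ∘ sym , ∉N[]⇒≢ ¬ap ∘ sym , ∉N[]⇒≢ ¬wp ∘ sym ,
                Adj-sym ab , bw , private⇒adj ab b-p ¬ap
      ... | inj₁ (u , wu , pendant) = ∉N[]⇒≢ ¬bq (trans (pendant q wq) (sym (pendant b (Adj-sym bw))))
        where
        wq : Adj G w q
        wq = private⇒adj bw w-q ¬bq
      ... | inj₂ (inj₁ N[w]⊆N[a]) = ∉N[]⇒¬adj ¬aq (N[w]⊆N[a] q (private⇒adj bw w-q ¬bq))
      ... | inj₂ (inj₂ N[w]≡V₂) = ∉N[]⇒¬adj ¬wr (from (N[w]≡V₂ r) (Adj-V₁⇒V₂ (private⇒adj (Adj-sym ab) a-r ¬br) a∈V₁))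

      𝔍₂⇒no-private-in-V₁ : (∀ y → Adj G a y ⇔ (InV₂ G side y × y ≢ b)) →
        (∀ x → Adj G b x ⇔ (InV₁ G side x × x ≢ a)) →
        ∀ w → InV₁ G side w → w ≢ a → ¬ HasPrivate₂ w a b
      𝔍₂⇒no-private-in-V₁ N[a]≡V₂∖b N[b]≡V₁∖a w w∈V₁ w≢a (q , w-q , ¬aq , ¬bq) =
        ∉N[]⇒¬adj ¬aq (from (N[a]≡V₂∖b q) (Adj-V₁⇒V₂ wq w∈V₁ , ∉N[]⇒≢ ¬bq))
        where
        wq : Adj G w q
        wq = private⇒adj (from (N[b]≡V₁∖a w) (w∈V₁ , w≢a)) w-q ¬bq

    universal⇒star : ∀ {v} → (∀ w → w ≢ v → Adj G v w) → IsStar G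
    universal⇒star {v} universal = v , universal , edge-at-v
      where
      edge-at-v : ∀ x y → Adj G x y → x ≡ v ⊎ y ≡ v
      edge-at-v x y xy with x ≟ v | y ≟ v
      ... | yes x≡v | _ = inj₁ x≡v
      ... | no _ | yes y≡v = inj₂ y≡v
      ... | no x≢v | no y≢v = ⊥-elim (bip x y xy
              (trans (Adj⇒opposite-sides (universal x x≢v)) (sym (Adj⇒opposite-sides (universal y y≢v)))))

    joined-pair⇒F₂ : ∀ {a b} → InV₁ G side a → InV₂ G side b →
      (∀ y → InV₂ G side y → Adj G a y) → (∀ x → InV₁ G side x → Adj G b x) → InF₂ G
    joined-pair⇒F₂ {a} {b} a∈V₁ b∈V₂ V₂⊆N[a] V₁⊆N[b] = side , bip , a , b , a∈V₁ , b∈V₂ ,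
      (λ y → mk⇔ (λ ay → Adj-V₁⇒V₂ ay a∈V₁) (V₂⊆N[a] y)) , (λ x → mk⇔ (λ bx → Adj-V₂⇒V₁ bx b∈V₂) (V₁⊆N[b] x))

    -- Condition (b) makes t adjacent to d, so condition (c) at a leaves only N(t) = V₁.
    N[a]∖b⇒N≡V₁ : ∀ {a b d} → 𝔍₁At side a b → InV₁ G side d → ¬ Adj G b d → Deg≥3 G a →
      ∀ t → Adj G a t → t ≢ b → ∀ z → Adj G t z ⇔ InV₁ G side z
    N[a]∖b⇒N≡V₁ {a} {b} {d} (_ , _ , ab , _ , _ , _ , cond-b , cond-c-a , _) d∈V₁ ¬bd deg≥3 t at t≢b
      with cond-c-a deg≥3 t at | Adj-sym (cond-b d d∈V₁ ¬bd t at t≢b)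
    ... | inj₁ (_ , _ , pendant) | td = ⊥-elim (¬bd (subst (Adj G b) (trans (pendant a (Adj-sym at)) (sym (pendant d td))) (Adj-sym ab)))
    ... | inj₂ (inj₁ N[t]⊆N[b]) | td = ⊥-elim (¬bd (N[t]⊆N[b] d td))
    ... | inj₂ (inj₂ N[t]≡V₁) | _ = N[t]≡V₁

    N[b]∖a⇒N≡V₂ : ∀ {a b} → 𝔍₁At side a b → (∀ t → Adj G a t → t ≢ b → ∀ z → Adj G t z ⇔ InV₁ G side z) →
      ∀ s → Adj G b s → s ≢ a → ∀ y → Adj G s y ⇔ InV₂ G side y
    N[b]∖a⇒N≡V₂ {a} {b} (_ , b∈V₂ , _ , _ , _ , cond-a , _) N[t]≡V₁ s bs s≢a y = mk⇔ (λ sy → Adj-V₁⇒V₂ sy s∈V₁) joined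
      where
      s∈V₁ : InV₁ G side s
      s∈V₁ = Adj-V₂⇒V₁ bs b∈V₂
      joined : InV₂ G side y → Adj G s y
      joined y∈V₂ with y ≟ b | adj? a y
      ... | yes refl | _ = Adj-sym bs
      ... | no y≢b | yes ay = Adj-sym (from (N[t]≡V₁ y ay y≢b s) s∈V₁)
      ... | no _ | no ¬ay = Adj-sym (cond-a y y∈V₂ ¬ay s bs s≢a)

    𝔍₁-deg≥3⇒F₂ : ∀ {a b d} → 𝔍₁At side a b → InV₁ G side d → ¬ Adj G b d → Deg≥3 G a → InF₂ G
    𝔍₁-deg≥3⇒F₂ {a} {b} 𝔍@(a∈V₁ , b∈V₂ , _ , deg-a , deg-b , _) d∈V₁ ¬bd deg≥3
      with deg≥2⇒neighbour-≢ deg-a b | deg≥2⇒neighbour-≢ deg-b a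
    ... | t , at , t≢b | s , bs , s≢a = side , bip , s , t , Adj-V₂⇒V₁ bs b∈V₂ , Adj-V₁⇒V₂ at a∈V₁ ,
          N[b]∖a⇒N≡V₂ 𝔍 N≡V₁ s bs s≢a , N≡V₁ t at t≢b
      where
      N≡V₁ : ∀ t → Adj G a t → t ≢ b → ∀ z → Adj G t z ⇔ InV₁ G side z
      N≡V₁ = N[a]∖b⇒N≡V₁ 𝔍 d∈V₁ ¬bd deg≥3

    -- With N(a) = {b, t}, every y ∈ V₂ ∖ {b, t} misses a, so condition (a) joins it to s.
    𝔍₁-deg≤2⇒V₂∖t⊆N : ∀ {a b s t} → 𝔍₁At side a b → ¬ Deg≥3 G a → Adj G a t → t ≢ b → Adj G b s → s ≢ a →
      ∀ y → InV₂ G side y → y ≢ t → Adj G s y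
    𝔍₁-deg≤2⇒V₂∖t⊆N {a} {b} (_ , _ , ab , _ , _ , cond-a , _) ¬deg≥3 at t≢b bs s≢a y y∈V₂ y≢t with y ≟ b | adj? a y
    ... | yes refl | _ = Adj-sym bs
    ... | no y≢b | yes ay = ⊥-elim (y≢t (¬deg≥3⇒neighbour-unique ¬deg≥3 ab at t≢b y ay y≢b))
    ... | no _ | no ¬ay = Adj-sym (cond-a y y∈V₂ ¬ay _ bs s≢a)

    𝔍₁-deg≤2⇒V₁∖s⊆N : ∀ {a b s t} → 𝔍₁At side a b → ¬ Deg≥3 G b → Adj G a t → t ≢ b → Adj G b s → s ≢ a →
      ∀ x → InV₁ G side x → x ≢ s → Adj G t x
    𝔍₁-deg≤2⇒V₁∖s⊆N {a} {b} (_ , _ , ab , _ , _ , _ , cond-b , _) ¬deg≥3 at t≢b bs s≢a x x∈V₁ x≢s with x ≟ a | adj? b x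
    ... | yes refl | _ = Adj-sym at
    ... | no x≢a | yes bx = ⊥-elim (x≢s (¬deg≥3⇒neighbour-unique ¬deg≥3 (Adj-sym ab) bs s≢a x bx x≢a))
    ... | no _ | no ¬bx = Adj-sym (cond-b x x∈V₁ ¬bx _ at t≢b)

    𝔍₁-deg≤2⇒F₂⊎F₃ : ∀ {a b} → 𝔍₁At side a b → ¬ Deg≥3 G a → ¬ Deg≥3 G b → InF₂ G ⊎ InF₃ G
    𝔍₁-deg≤2⇒F₂⊎F₃ {a} {b} 𝔍@(a∈V₁ , b∈V₂ , _ , deg-a , deg-b , _) ¬deg≥3-a ¬deg≥3-b
      with deg≥2⇒neighbour-≢ deg-a b | deg≥2⇒neighbour-≢ deg-b a
    ... | t , at , t≢b | s , bs , s≢a = pair-type (adj? s t)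
      where
      s∈V₁ : InV₁ G side s
      s∈V₁ = Adj-V₂⇒V₁ bs b∈V₂
      t∈V₂ : InV₂ G side t
      t∈V₂ = Adj-V₁⇒V₂ at a∈V₁
      V₂∖t⊆N[s] : ∀ y → InV₂ G side y → y ≢ t → Adj G s y
      V₂∖t⊆N[s] = 𝔍₁-deg≤2⇒V₂∖t⊆N 𝔍 ¬deg≥3-a at t≢b bs s≢a
      V₁∖s⊆N[t] : ∀ x → InV₁ G side x → x ≢ s → Adj G t x
      V₁∖s⊆N[t] = 𝔍₁-deg≤2⇒V₁∖s⊆N 𝔍 ¬deg≥3-b at t≢b bs s≢a
      pair-type : Dec (Adj G s t) → InF₂ G ⊎ InF₃ G
      pair-type (yes st) = inj₁ (joined-pair⇒F₂ s∈V₁ t∈V₂ V₂⊆N[s] V₁⊆N[t])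
        where
        V₂⊆N[s] : ∀ y → InV₂ G side y → Adj G s y
        V₂⊆N[s] y y∈V₂ with y ≟ t
        ... | yes refl = st
        ... | no y≢t = V₂∖t⊆N[s] y y∈V₂ y≢t
        V₁⊆N[t] : ∀ x → InV₁ G side x → Adj G t x
        V₁⊆N[t] x x∈V₁ with x ≟ s
        ... | yes refl = Adj-sym st
        ... | no x≢s = V₁∖s⊆N[t] x x∈V₁ x≢s
      pair-type (no ¬st) = inj₂ (side , bip , s , t , s∈V₁ , t∈V₂ , ¬st ,
        (λ y → mk⇔ (λ sy → Adj-V₁⇒V₂ sy s∈V₁ , λ { refl → ¬st sy }) (uncurry (V₂∖t⊆N[s] y))) ,
        (λ x → mk⇔ (λ tx → Adj-V₂⇒V₁ tx t∈V₂ , λ { refl → ¬st (Adj-sym tx) }) (uncurry (V₁∖s⊆N[t] x))))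

    -- b is the centre of the star on L₁ = N(b) ∖ {a}, t the second neighbour of a, S = L₁ ∩ N(t),
    -- and the remaining vertices are the leaves of the star at t.
    module F₁-Construction {a b t : Fin n} (a∈V₁ : InV₁ G side a) (b∈V₂ : InV₂ G side b) (ab : Adj G a b)
      (cond-b : ∀ x → InV₁ G side x → ¬ Adj G b x → ∀ y → Adj G a y → y ≢ b → Adj G x y)
      (V₂⊆N[a] : ∀ y → InV₂ G side y → Adj G a y) (¬deg≥3 : ¬ Deg≥3 G a) (at : Adj G a t) (t≢b : t ≢ b) where

      L₁? : ∀ w → Dec (Adj G b w × w ≢ a)
      L₁? w = adj? b w ×-dec ¬? (w ≟ a)

      L₁ : Subset n
      L₁ = subset L₁?

      S? : ∀ w → Dec ((Adj G b w × w ≢ a) × Adj G t w)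
      S? w = L₁? w ×-dec adj? t w

      S : Subset n
      S = subset S?

      t∈V₂ : InV₂ G side t
      t∈V₂ = Adj-V₁⇒V₂ at a∈V₁

      V₂⊆bt : ∀ y → InV₂ G side y → y ≡ b ⊎ y ≡ t
      V₂⊆bt y y∈V₂ with y ≟ b
      ... | yes y≡b = inj₁ y≡b
      ... | no y≢b = inj₂ (¬deg≥3⇒neighbour-unique ¬deg≥3 ab at t≢b y (V₂⊆N[a] y y∈V₂) y≢b)

      K : Fin n → Fin n → Set
      K = KEdge G b t a L₁ S

      Adj⇒K : ∀ u w → InV₂ G side u → Adj G u w → K u w ⊎ K w u
      Adj⇒K u w u∈V₂ uw with V₂⊆bt u u∈V₂ | w ≟ a
      ... | inj₁ refl | yes refl = inj₂ (inj₂ (inj₂ (inj₁ (refl , refl))))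
      ... | inj₁ refl | no w≢a = inj₁ (inj₁ (refl , ∈-subset⁺ L₁? (uw , w≢a)))
      ... | inj₂ refl | yes refl = inj₂ (inj₂ (inj₂ (inj₂ (inj₁ (refl , refl)))))
      ... | inj₂ refl | no w≢a with adj? b w
      ...   | yes bw = inj₁ (inj₂ (inj₂ (inj₂ (inj₂ (refl , ∈-subset⁺ S? ((bw , w≢a) , uw))))))
      ...   | no ¬bw = inj₁ (inj₂ (inj₁ (refl , (λ { refl → same-side⇒¬Adj (trans t∈V₂ (sym b∈V₂)) uw }) ,
                        Adj⇒≢ uw ∘ sym , w≢a , ¬bw ∘ proj₁ ∘ ∈-subset⁻ L₁?)))

      L₂⊆V₁ : ∀ {w} → w ≢ b → w ≢ t → InV₁ G side w
      L₂⊆V₁ {w} w≢b w≢t with side w Bool.≟ true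
      ... | yes w∈V₁ = w∈V₁
      ... | no w∉V₁ = ⊥-elim ([ w≢b , w≢t ] (V₂⊆bt w (¬-not w∉V₁)))

      K⇒Adj : ∀ u w → K u w → Adj G u w
      K⇒Adj u w (inj₁ (refl , w∈L₁)) = proj₁ (∈-subset⁻ L₁? w∈L₁)
      K⇒Adj u w (inj₂ (inj₁ (refl , w≢b , w≢t , w≢a , w∉L₁))) =
        Adj-sym (cond-b w (L₂⊆V₁ w≢b w≢t) (λ bw → w∉L₁ (∈-subset⁺ L₁? (bw , w≢a))) t at t≢b)
      K⇒Adj u w (inj₂ (inj₂ (inj₁ (refl , refl)))) = ab
      K⇒Adj u w (inj₂ (inj₂ (inj₂ (inj₁ (refl , refl))))) = at
      K⇒Adj u w (inj₂ (inj₂ (inj₂ (inj₂ (refl , w∈S))))) = proj₂ (∈-subset⁻ S? w∈S)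

      edges : F₁Edges G b t a L₁ S
      edges u w = mk⇔ Adj⇒K⊎K [ K⇒Adj u w , Adj-sym ∘ K⇒Adj w u ]
        where
        Adj⇒K⊎K : Adj G u w → K u w ⊎ K w u
        Adj⇒K⊎K uw with side u Bool.≟ true
        ... | yes u∈V₁ = Sum.swap (Adj⇒K w u (Adj-V₁⇒V₂ uw u∈V₁) (Adj-sym uw))
        ... | no u∉V₁ = Adj⇒K u w (¬-not u∉V₁) uw

    𝔍₁⇒F₁ : ∀ {a b d} → 𝔍₁At side a b → (∀ y → InV₂ G side y → Adj G a y) →
      InV₁ G side d → ¬ Adj G b d → ¬ Deg≥3 G a → InF₁ G
    𝔍₁⇒F₁ {a} {b} {d} (a∈V₁ , b∈V₂ , ab , deg-a , deg-b , _ , cond-b , _) V₂⊆N[a] d∈V₁ ¬bd ¬deg≥3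
      with deg≥2⇒neighbour-≢ deg-a b | deg≥2⇒neighbour-≢ deg-b a
    ... | t , at , t≢b | l , bl , l≢a =
      (side , bip) , b , t , a , L₁ , S , t≢b ∘ sym , V₁-V₂⇒≢ a∈V₁ b∈V₂ ∘ sym , Adj⇒≢ at ∘ sym ,
      (λ b∈L₁ → Adj-irrefl (proj₁ (∈-subset⁻ L₁? b∈L₁))) ,
      (λ t∈L₁ → same-side⇒¬Adj (trans b∈V₂ (sym t∈V₂)) (proj₁ (∈-subset⁻ L₁? t∈L₁))) ,
      (λ a∈L₁ → proj₂ (∈-subset⁻ L₁? a∈L₁) refl) ,
      (l , ∈-subset⁺ L₁? (bl , l≢a)) ,
      (d , V₁-V₂⇒≢ d∈V₁ b∈V₂ , V₁-V₂⇒≢ d∈V₁ t∈V₂ , (λ { refl → ¬bd (Adj-sym ab) }) , ¬bd ∘ proj₁ ∘ ∈-subset⁻ L₁?) ,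
      (λ w∈S → ∈-subset⁺ L₁? (proj₁ (∈-subset⁻ S? w∈S))) ,
      edges
      where open F₁-Construction a∈V₁ b∈V₂ ab cond-b V₂⊆N[a] ¬deg≥3 at t≢b

    module F₁-Structure {v₁ x v₂ : Fin n} {L₁ S : Subset n} (v₁≢x : v₁ ≢ x) (v₁≢v₂ : v₁ ≢ v₂) (x≢v₂ : x ≢ v₂)
      (v₂∉L₁ : v₂ ∉ L₁) (S⊆L₁ : S ⊆ L₁) (edges : F₁Edges G v₁ x v₂ L₁ S) (v₁∈V₁ : InV₁ G side v₁) where

      K⇒Adj : ∀ u w → KEdge G v₁ x v₂ L₁ S u w → Adj G u w
      K⇒Adj u w k = from (edges u w) (inj₁ k)

      v₂v₁ : Adj G v₂ v₁
      v₂v₁ = K⇒Adj v₂ v₁ (inj₂ (inj₂ (inj₁ (refl , refl))))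

      v₂x : Adj G v₂ x
      v₂x = K⇒Adj v₂ x (inj₂ (inj₂ (inj₂ (inj₁ (refl , refl)))))

      v₂∈V₂ : InV₂ G side v₂
      v₂∈V₂ = Adj-V₁⇒V₂ (Adj-sym v₂v₁) v₁∈V₁

      x∈V₁ : InV₁ G side x
      x∈V₁ = Adj-V₂⇒V₁ v₂x v₂∈V₂

      N[v₂]⊆v₁x : ∀ w → Adj G v₂ w → w ≡ v₁ ⊎ w ≡ x
      N[v₂]⊆v₁x w v₂w with to (edges v₂ w) v₂w
      ... | inj₁ (inj₁ (v₂≡v₁ , _)) = ⊥-elim (v₁≢v₂ (sym v₂≡v₁))
      ... | inj₁ (inj₂ (inj₁ (v₂≡x , _))) = ⊥-elim (x≢v₂ (sym v₂≡x))
      ... | inj₁ (inj₂ (inj₂ (inj₁ (_ , w≡v₁)))) = inj₁ w≡v₁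
      ... | inj₁ (inj₂ (inj₂ (inj₂ (inj₁ (_ , w≡x))))) = inj₂ w≡x
      ... | inj₁ (inj₂ (inj₂ (inj₂ (inj₂ (v₂≡x , _))))) = ⊥-elim (x≢v₂ (sym v₂≡x))
      ... | inj₂ (inj₁ (_ , v₂∈L₁)) = ⊥-elim (v₂∉L₁ v₂∈L₁)
      ... | inj₂ (inj₂ (inj₁ (_ , _ , _ , v₂≢v₂ , _))) = ⊥-elim (v₂≢v₂ refl)
      ... | inj₂ (inj₂ (inj₂ (inj₁ (_ , v₂≡v₁)))) = ⊥-elim (v₁≢v₂ (sym v₂≡v₁))
      ... | inj₂ (inj₂ (inj₂ (inj₂ (inj₁ (_ , v₂≡x))))) = ⊥-elim (x≢v₂ (sym v₂≡x))
      ... | inj₂ (inj₂ (inj₂ (inj₂ (inj₂ (_ , v₂∈S))))) = ⊥-elim (v₂∉L₁ (S⊆L₁ v₂∈S))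

      -- Every other vertex is a leaf of the star at v₁ or at x, hence on the opposite side of its centre.
      V₁⊆v₁x : ∀ w → InV₁ G side w → w ≡ v₁ ⊎ w ≡ x
      V₁⊆v₁x w w∈V₁ with w ≟ v₁ | w ≟ x | w ≟ v₂
      ... | yes w≡v₁ | _ | _ = inj₁ w≡v₁
      ... | no _ | yes w≡x | _ = inj₂ w≡x
      ... | no _ | no _ | yes refl = ⊥-elim (V₁-V₂⇒≢ w∈V₁ v₂∈V₂ refl)
      ... | no w≢v₁ | no w≢x | no w≢v₂ with w ∈? L₁
      ...   | yes w∈L₁ = ⊥-elim (same-side⇒¬Adj (trans v₁∈V₁ (sym w∈V₁)) (K⇒Adj v₁ w (inj₁ (refl , w∈L₁))))
      ...   | no w∉L₁ = ⊥-elim (same-side⇒¬Adj (trans x∈V₁ (sym w∈V₁))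
                          (K⇒Adj x w (inj₂ (inj₁ (refl , w≢v₁ , w≢x , w≢v₂ , w∉L₁)))))

      cond-a : ∀ y → InV₂ G side y → ¬ Adj G v₁ y → ∀ z → Adj G v₂ z → z ≢ v₁ → Adj G y z
      cond-a y y∈V₂ ¬v₁y z v₂z z≢v₁ with N[v₂]⊆v₁x z v₂z
      ... | inj₁ z≡v₁ = ⊥-elim (z≢v₁ z≡v₁)
      ... | inj₂ refl with y ≟ v₂ | y ∈? L₁
      ...   | yes refl | _ = ⊥-elim (¬v₁y (Adj-sym v₂v₁))
      ...   | no _ | yes y∈L₁ = ⊥-elim (¬v₁y (K⇒Adj v₁ y (inj₁ (refl , y∈L₁))))
      ...   | no y≢v₂ | no y∉L₁ = Adj-sym (K⇒Adj z y (inj₂ (inj₁ (refl ,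
                (λ { refl → V₁-V₂⇒≢ v₁∈V₁ y∈V₂ refl }) , (λ { refl → V₁-V₂⇒≢ x∈V₁ y∈V₂ refl }) , y≢v₂ , y∉L₁))))

      𝔍₁-at : ∀ {l} → l ∈ L₁ → 𝔍₁At side v₁ v₂
      𝔍₁-at l∈L₁ = v₁∈V₁ , v₂∈V₂ , Adj-sym v₂v₁ ,
        (v₂ , _ , (λ { refl → v₂∉L₁ l∈L₁ }) , Adj-sym v₂v₁ , K⇒Adj v₁ _ (inj₁ (refl , l∈L₁))) ,
        (v₁ , x , v₁≢x , v₂v₁ , v₂x) , cond-a ,
        (λ w w∈V₁ ¬v₂w _ _ _ → ⊥-elim (¬v₂w ([ (λ { refl → v₂v₁ }) , (λ { refl → v₂x }) ] (V₁⊆v₁x w w∈V₁)))) ,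
        (λ _ t v₁t → inj₂ (inj₁ λ z tz →
          [ (λ { refl → v₂v₁ }) , (λ { refl → v₂x }) ] (V₁⊆v₁x z (Adj-V₂⇒V₁ tz (Adj-V₁⇒V₂ v₁t v₁∈V₁))))) ,
        (λ (p , q , r , p≢q , p≢r , q≢r , v₂p , v₂q , v₂r) →
          ⊥-elim (¬three-in-pair (N[v₂]⊆v₁x p v₂p) (N[v₂]⊆v₁x q v₂q) (N[v₂]⊆v₁x r v₂r) p≢q p≢r q≢r))

    F₂⇒Deg≥2 : ∀ {v₁ v₂} → ¬ IsStar G → InV₂ G side v₂ →
      (∀ y → Adj G v₁ y ⇔ InV₂ G side y) → (∀ x → Adj G v₂ x ⇔ InV₁ G side x) → Deg≥2 G v₁
    F₂⇒Deg≥2 {v₁} {v₂} ¬star v₂∈V₂ N[v₁]≡V₂ N[v₂]≡V₁ with any? (λ y → (side y Bool.≟ false) ×-dec ¬? (y ≟ v₂))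
    ... | yes (y , y∈V₂ , y≢v₂) = v₂ , y , y≢v₂ ∘ sym , from (N[v₁]≡V₂ v₂) v₂∈V₂ , from (N[v₁]≡V₂ y) y∈V₂
    ... | no V₂⊆v₂ = ⊥-elim (¬star (universal⇒star λ w w≢v₂ →
            from (N[v₂]≡V₁ w) (¬-not λ w∈V₂ → V₂⊆v₂ (w , w∈V₂ , w≢v₂))))

  Adj-private⇒Deg≥2 : ∀ {a b} → Adj G a b → HasPrivate a b → Deg≥2 G a
  Adj-private⇒Deg≥2 {b = b} ab (p , a-p , ¬bp) = b , p , ∉N[]⇒≢ ¬bp ∘ sym , ab , private⇒adj (Adj-sym ab) a-p ¬bp

  adjacent-SplitMaximalPair⇒𝔍₁ : ∀ {side} → IsBipartition G side → ∀ {a b} →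
    SplitMaximalPair side a b → Adj G a b → 𝔍₁At side a b
  adjacent-SplitMaximalPair⇒𝔍₁ {side} bip (a∈V₁ , b∈V₂ , private-a , private-b , maximal) ab =
    a∈V₁ , b∈V₂ , ab , Adj-private⇒Deg≥2 ab private-a , Adj-private⇒Deg≥2 (Adj-sym ab) private-b ,
    (λ y y∈V₂ → maximalPair⇒𝔍₁-b (opposite side) (IsBipartition-opposite bip) (cong not b∈V₂) (cong not a∈V₁)
                  (Adj-sym ab) private-a (MaximalPair-sym maximal) y (cong not y∈V₂)) ,
    maximalPair⇒𝔍₁-b side bip a∈V₁ b∈V₂ ab private-b maximal ,
    maximalPair⇒𝔍₁-c side bip a∈V₁ b∈V₂ ab private-b maximal ,
    CondC-opposite⁻ false (maximalPair⇒𝔍₁-c (opposite side) (IsBipartition-opposite bip) (cong not b∈V₂) (cong not a∈V₁)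
                             (Adj-sym ab) private-a (MaximalPair-sym maximal))

  nonadjacent-SplitMaximalPair⇒𝔍₂ : ∀ {side} → IsBipartition G side → ∀ {a b} →
    SplitMaximalPair side a b → ¬ Adj G a b → 𝔍₂At side a b
  nonadjacent-SplitMaximalPair⇒𝔍₂ {side} bip (a∈V₁ , b∈V₂ , _ , _ , maximal) ¬ab =
    a∈V₁ , b∈V₂ , ¬ab , maximalPair⇒𝔍₂-N side bip a∈V₁ b∈V₂ ¬ab maximal ,
    λ x → opposite-⇔⁻ true (maximalPair⇒𝔍₂-N (opposite side) (IsBipartition-opposite bip) (cong not b∈V₂) (cong not a∈V₁)
                              (¬ab ∘ Adj-sym) (MaximalPair-sym maximal) x)

  SplitMaximalPair⇒𝔍 : ∀ {side} → IsBipartition G side → ∀ {a b} → SplitMaximalPair side a b →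
    Property𝔍₁ G side ⊎ Property𝔍₂ G side
  SplitMaximalPair⇒𝔍 bip {a} {b} pair with adj? a b
  ... | yes ab = inj₁ (a , b , adjacent-SplitMaximalPair⇒𝔍₁ bip pair ab)
  ... | no ¬ab = inj₂ (a , b , nonadjacent-SplitMaximalPair⇒𝔍₂ bip pair ¬ab)

  𝔍₁⇒SplitMaximalPair : ∀ {side} → IsBipartition G side → ∀ {a b} → 𝔍₁At side a b → SplitMaximalPair side a b
  𝔍₁⇒SplitMaximalPair {side} bip {a} {b} 𝔍@(a∈V₁ , b∈V₂ , ab , deg-a , deg-b , _ , cond-b , _ , cond-c-b)
    with deg≥2⇒neighbour-≢ deg-a b | deg≥2⇒neighbour-≢ deg-b a
  ... | p , ap , p≢b | q , bq , q≢a =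
    a∈V₁ , b∈V₂ , (p , inj₂ ap , V₂∉N[b] side bip a∈V₁ b∈V₂ (Adj-V₁⇒V₂ side bip ap a∈V₁) p≢b) ,
    (q , inj₂ bq , V₁∉N[a] side bip a∈V₁ b∈V₂ (Adj-V₂⇒V₁ side bip bq b∈V₂) q≢a) , maximal
    where
    maximal : MaximalPair a b
    maximal w w≢a w≢b (pa , pb , pw) with side w Bool.≟ true | 𝔍₁At-opposite 𝔍
    ... | yes w∈V₁ | _ = 𝔍₁⇒no-triple-in-V₁ side bip a∈V₁ b∈V₂ ab cond-b cond-c-b w w∈V₁ w≢a w≢b (pa , pb , pw)
    ... | no w∉V₁ | (b∈V₁′ , a∈V₂′ , ba , _ , _ , _ , cond-a′ , _ , cond-c-a′) =
      𝔍₁⇒no-triple-in-V₁ (opposite side) (IsBipartition-opposite bip) b∈V₁′ a∈V₂′ ba cond-a′ cond-c-a′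
        w (cong not (¬-not w∉V₁)) w≢b w≢a (pb , pa , HasPrivate₂-swap pw)

  𝔍₂⇒SplitMaximalPair : ∀ {side} → IsBipartition G side → ∀ {a b} → 𝔍₂At side a b → SplitMaximalPair side a b
  𝔍₂⇒SplitMaximalPair {side} bip {a} {b} (a∈V₁ , b∈V₂ , ¬ab , N[a]≡V₂∖b , N[b]≡V₁∖a) =
    a∈V₁ , b∈V₂ , (a , inj₁ refl , ∉N[] a≢b (¬ab ∘ Adj-sym)) , (b , inj₁ refl , ∉N[] (a≢b ∘ sym) ¬ab) , maximal
    where
    a≢b : a ≢ b
    a≢b = V₁-V₂⇒≢ side bip a∈V₁ b∈V₂
    maximal : MaximalPair a b
    maximal w w≢a w≢b (_ , _ , pw) with side w Bool.≟ true
    ... | yes w∈V₁ = 𝔍₂⇒no-private-in-V₁ side bip a∈V₁ b∈V₂ N[a]≡V₂∖b N[b]≡V₁∖a w w∈V₁ w≢a pw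
    ... | no w∉V₁ = 𝔍₂⇒no-private-in-V₁ (opposite side) (IsBipartition-opposite bip) (cong not b∈V₂) (cong not a∈V₁)
          (λ x → opposite-⇔ true (N[b]≡V₁∖a x)) (λ y → opposite-⇔ false (N[a]≡V₂∖b y))
          w (cong not (¬-not w∉V₁)) w≢b (HasPrivate₂-swap pw)

  𝔍⇒SplitMaximalPair : ∀ {side} → IsBipartition G side → Property𝔍₁ G side ⊎ Property𝔍₂ G side →
    ∃[ a ] ∃[ b ] SplitMaximalPair side a b
  𝔍⇒SplitMaximalPair bip (inj₁ (a , b , 𝔍)) = a , b , 𝔍₁⇒SplitMaximalPair bip 𝔍
  𝔍⇒SplitMaximalPair bip (inj₂ (a , b , 𝔍)) = a , b , 𝔍₂⇒SplitMaximalPair bip 𝔍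

  irrColorable-2⇒SplitMaximalPair : Fin n → ¬ IsStar G → IrrColorable G 2 →
    ∃[ side ] (IsBipartition G side × ∃[ a ] ∃[ b ] SplitMaximalPair side a b)
  irrColorable-2⇒SplitMaximalPair v₀ ¬star (c , proper , R , mir , rainbow) =
    side , bip , pair (any? λ a → a ∈? R ×-dec side a Bool.≟ true) (any? λ b → b ∈? R ×-dec side b Bool.≟ false)
    where
    side : Fin n → Bool
    side = Inverse.to 2↔Bool ∘ c
    side-injective : ∀ {u v} → side u ≡ side v → c u ≡ c v
    side-injective {u} {v} su≡sv = begin
      c u                             ≡⟨ Inverse.strictlyInverseʳ 2↔Bool (c u) ⟨
      Inverse.from 2↔Bool (side u)    ≡⟨ cong (Inverse.from 2↔Bool) su≡sv ⟩
      Inverse.from 2↔Bool (side v)    ≡⟨ Inverse.strictlyInverseʳ 2↔Bool (c v) ⟩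
      c v                             ∎
    bip : IsBipartition G side
    bip u v uv = proper u v uv ∘ side-injective
    R-side-injective : ∀ {u v} → u ∈ R → v ∈ R → side u ≡ side v → u ≡ v
    R-side-injective {u} {v} u∈R v∈R su≡sv with u ≟ v
    ... | yes u≡v = u≡v
    ... | no u≢v = ⊥-elim (rainbow u v u∈R v∈R u≢v (side-injective su≡sv))
    one-sided : ∀ {s} → (∀ t → t ∈ R → side t ≡ s) → ⊥
    one-sided R-on-s = let v , v∈R = maximalIrredundant-nonempty v₀ mir in
      ¬star (universal⇒star side bip (maximalIrredundant-singleton⇒universal v∈R
        (λ t t∈R → R-side-injective t∈R v∈R (trans (R-on-s t t∈R) (sym (R-on-s v v∈R)))) mir))
    pair : Dec (∃[ a ] (a ∈ R × InV₁ G side a)) → Dec (∃[ b ] (b ∈ R × InV₂ G side b)) →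
      ∃[ a ] ∃[ b ] SplitMaximalPair side a b
    pair (yes (a , a∈R , a∈V₁)) (yes (b , b∈R , b∈V₂)) =
      a , b , a∈V₁ , b∈V₂ , maximalIrredundant-pair⁻ a∈R b∈R (V₁-V₂⇒≢ side bip a∈V₁ b∈V₂) R⊆ab mir
      where
      R⊆ab : ∀ t → t ∈ R → t ≡ a ⊎ t ≡ b
      R⊆ab t t∈R with side t Bool.≟ true
      ... | yes t∈V₁ = inj₁ (R-side-injective t∈R a∈R (trans t∈V₁ (sym a∈V₁)))
      ... | no t∉V₁ = inj₂ (R-side-injective t∈R b∈R (trans (¬-not t∉V₁) (sym b∈V₂)))
    pair (no R∩V₁≡∅) _ = ⊥-elim (one-sided λ t t∈R → ¬-not λ t∈V₁ → R∩V₁≡∅ (t , t∈R , t∈V₁))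
    pair _ (no R∩V₂≡∅) = ⊥-elim (one-sided λ t t∈R → ¬-not λ t∈V₂ → R∩V₂≡∅ (t , t∈R , t∈V₂))

  SplitMaximalPair⇒χ≡2 : NoIsolated G → ∀ {side} → IsBipartition G side → ∀ {a b} →
    SplitMaximalPair side a b → IsChiI G 2
  SplitMaximalPair⇒χ≡2 noIsolated {side} bip {a} {b} (a∈V₁ , b∈V₂ , private-a , private-b , maximal) =
    irrColorable-2⇒χ≡2 noIsolated a (bipartition⇒irrColorable-2 bip mir R-split)
    where
    R⊆ab : ∀ t → t ∈ ⁅ a ⁆ ∪ ⁅ b ⁆ → t ≡ a ⊎ t ≡ b
    R⊆ab t t∈ = Sum.map (x∈⁅y⁆⇒x≡y a) (x∈⁅y⁆⇒x≡y b) (x∈p∪q⁻ ⁅ a ⁆ ⁅ b ⁆ t∈)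
    mir : MaximalIrredundant G (⁅ a ⁆ ∪ ⁅ b ⁆)
    mir = maximalIrredundant-pair⁺ (x∈p∪q⁺ (inj₁ (x∈⁅x⁆ a))) (x∈p∪q⁺ (inj₂ (x∈⁅x⁆ b)))
            (V₁-V₂⇒≢ side bip a∈V₁ b∈V₂) R⊆ab private-a private-b maximal
    R-split : ∀ u v → u ∈ ⁅ a ⁆ ∪ ⁅ b ⁆ → v ∈ ⁅ a ⁆ ∪ ⁅ b ⁆ → u ≢ v → side u ≢ side v
    R-split u v u∈ v∈ u≢v with R⊆ab u u∈ | R⊆ab v v∈
    ... | inj₁ refl | inj₁ refl = ⊥-elim (u≢v refl)
    ... | inj₂ refl | inj₂ refl = ⊥-elim (u≢v refl)
    ... | inj₁ refl | inj₂ refl = V₁-V₂⇒side≢ side a∈V₁ b∈V₂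
    ... | inj₂ refl | inj₁ refl = V₁-V₂⇒side≢ side a∈V₁ b∈V₂ ∘ sym

  χ≡2⇔𝔍 : Fin n → NoIsolated G → ¬ IsStar G →
    IsChiI G 2 ⇔ (∃[ side ] (IsBipartition G side × (Property𝔍₁ G side ⊎ Property𝔍₂ G side)))
  χ≡2⇔𝔍 v₀ noIsolated ¬star = mk⇔
    (λ (colourable , _) → let side , bip , _ , _ , pair = irrColorable-2⇒SplitMaximalPair v₀ ¬star colourable in
                          side , bip , SplitMaximalPair⇒𝔍 bip pair)
    (λ (side , bip , 𝔍) → let _ , _ , pair = 𝔍⇒SplitMaximalPair bip 𝔍 in SplitMaximalPair⇒χ≡2 noIsolated bip pair)

  -- A vertex of V₁ ∖ N(b) forces F₂ through condition (c) at a; otherwise b dominates V₁, and F₁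
  -- appears exactly when a does not dominate V₂ and deg b ≤ 2.
  𝔍₁-deg≥3⇒F : ∀ {side} → IsBipartition G side → ∀ {a b} → 𝔍₁At side a b → Deg≥3 G a → InF₁ G ⊎ InF₂ G ⊎ InF₃ G
  𝔍₁-deg≥3⇒F {side} bip {a} {b} 𝔍@(a∈V₁ , b∈V₂ , _) deg≥3-a
    with ⇒-or-counterexample (λ x → side x Bool.≟ true) (adj? b)
  ... | inj₂ (d , d∈V₁ , ¬bd) = inj₂ (inj₁ (𝔍₁-deg≥3⇒F₂ side bip 𝔍 d∈V₁ ¬bd deg≥3-a))
  ... | inj₁ V₁⊆N[b] with ⇒-or-counterexample (λ y → side y Bool.≟ false) (adj? a)
  ...   | inj₁ V₂⊆N[a] = inj₂ (inj₁ (joined-pair⇒F₂ side bip a∈V₁ b∈V₂ V₂⊆N[a] V₁⊆N[b]))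
  ...   | inj₂ (c , c∈V₂ , ¬ac) with deg≥3? b
  ...     | yes deg≥3-b = inj₂ (inj₁ (𝔍₁-deg≥3⇒F₂ (opposite side) (IsBipartition-opposite bip) (𝔍₁At-opposite 𝔍)
                            (cong not c∈V₂) ¬ac deg≥3-b))
  ...     | no ¬deg≥3-b = inj₁ (𝔍₁⇒F₁ (opposite side) (IsBipartition-opposite bip) (𝔍₁At-opposite 𝔍)
                            (λ y y∈ → V₁⊆N[b] y (not-injective {side y} {true} y∈)) (cong not c∈V₂) ¬ac ¬deg≥3-b)

  𝔍₁⇒F : ∀ {side} → IsBipartition G side → ∀ {a b} → 𝔍₁At side a b → InF₁ G ⊎ InF₂ G ⊎ InF₃ G
  𝔍₁⇒F {side} bip {a} {b} 𝔍 with deg≥3? a | deg≥3? b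
  ... | yes deg≥3-a | _ = 𝔍₁-deg≥3⇒F bip 𝔍 deg≥3-a
  ... | no _ | yes deg≥3-b = 𝔍₁-deg≥3⇒F (IsBipartition-opposite bip) (𝔍₁At-opposite 𝔍) deg≥3-b
  ... | no ¬deg≥3-a | no ¬deg≥3-b = inj₂ (𝔍₁-deg≤2⇒F₂⊎F₃ side bip 𝔍 ¬deg≥3-a ¬deg≥3-b)

  F₁⇒𝔍₁ : InF₁ G → ∃[ side ] (IsBipartition G side × Property𝔍₁ G side)
  F₁⇒𝔍₁ ((side , bip) , v₁ , x , v₂ , L₁ , S , v₁≢x , v₁≢v₂ , x≢v₂ , _ , _ , v₂∉L₁ , (l , l∈L₁) , _ , S⊆L₁ , edges)
    with side v₁ Bool.≟ true
  ... | yes v₁∈V₁ = side , bip , v₁ , v₂ ,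
        F₁-Structure.𝔍₁-at side bip v₁≢x v₁≢v₂ x≢v₂ v₂∉L₁ S⊆L₁ edges v₁∈V₁ l∈L₁
  ... | no v₁∉V₁ = opposite side , IsBipartition-opposite bip , v₁ , v₂ ,
        F₁-Structure.𝔍₁-at (opposite side) (IsBipartition-opposite bip) v₁≢x v₁≢v₂ x≢v₂ v₂∉L₁ S⊆L₁ edges
          (cong not (¬-not v₁∉V₁)) l∈L₁

  F₂⇒𝔍₁ : ¬ IsStar G → InF₂ G → ∃[ side ] (IsBipartition G side × Property𝔍₁ G side)
  F₂⇒𝔍₁ ¬star (side , bip , v₁ , v₂ , v₁∈V₁ , v₂∈V₂ , N[v₁]≡V₂ , N[v₂]≡V₁) =
    side , bip , v₁ , v₂ , v₁∈V₁ , v₂∈V₂ , from (N[v₁]≡V₂ v₂) v₂∈V₂ ,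
    F₂⇒Deg≥2 side bip ¬star v₂∈V₂ N[v₁]≡V₂ N[v₂]≡V₁ ,
    F₂⇒Deg≥2 (opposite side) (IsBipartition-opposite bip) ¬star (cong not v₁∈V₁)
      (λ x → not-⇔ ⇔-∘ N[v₂]≡V₁ x) (λ y → not-⇔ ⇔-∘ N[v₁]≡V₂ y) ,
    (λ y y∈V₂ ¬v₁y → ⊥-elim (¬v₁y (from (N[v₁]≡V₂ y) y∈V₂))) ,
    (λ x x∈V₁ ¬v₂x → ⊥-elim (¬v₂x (from (N[v₂]≡V₁ x) x∈V₁))) ,
    (λ _ t v₁t → inj₂ (inj₁ λ z tz → from (N[v₂]≡V₁ z) (Adj-V₂⇒V₁ side bip tz (to (N[v₁]≡V₂ t) v₁t)))) ,
    (λ _ t v₂t → inj₂ (inj₁ λ z tz → from (N[v₁]≡V₂ z) (Adj-V₁⇒V₂ side bip tz (to (N[v₂]≡V₁ t) v₂t))))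

  𝔍⇔F : ¬ IsStar G →
    (∃[ side ] (IsBipartition G side × (Property𝔍₁ G side ⊎ Property𝔍₂ G side))) ⇔ (InF₁ G ⊎ InF₂ G ⊎ InF₃ G)
  𝔍⇔F ¬star = mk⇔ 𝔍⇒F F⇒𝔍
    where
    𝔍⇒F : ∃[ side ] (IsBipartition G side × (Property𝔍₁ G side ⊎ Property𝔍₂ G side)) → InF₁ G ⊎ InF₂ G ⊎ InF₃ G
    𝔍⇒F (side , bip , inj₁ (_ , _ , 𝔍)) = 𝔍₁⇒F bip 𝔍
    𝔍⇒F (side , bip , inj₂ 𝔍₂) = inj₂ (inj₂ (side , bip , 𝔍₂))
    F⇒𝔍 : InF₁ G ⊎ InF₂ G ⊎ InF₃ G → ∃[ side ] (IsBipartition G side × (Property𝔍₁ G side ⊎ Property𝔍₂ G side))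
    F⇒𝔍 (inj₁ F₁) = map₂ (map₂ inj₁) (F₁⇒𝔍₁ F₁)
    F⇒𝔍 (inj₂ (inj₁ F₂)) = map₂ (map₂ inj₁) (F₂⇒𝔍₁ ¬star F₂)
    F⇒𝔍 (inj₂ (inj₂ (side , bip , 𝔍₂))) = side , bip , inj₂ 𝔍₂
module _ {n : ℕ} (G : Graph (suc n)) where

  -- Recolour v with the colour of a non-neighbour u and punch v's colour out; v avoids R.
  nonadjacent⇒irrColorable-pred : NoIsolated G → ∀ {u v} → u ≢ v → ¬ Adj G u v → IrrColorable G n
  nonadjacent⇒irrColorable-pred noIsolated {u} {v} u≢v ¬uv = merged-colouring (∃-maximalIrredundant-∌ G noIsolated v)
    where
    merge : Fin (suc n) → Fin (suc n)
    merge w with w ≟ v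
    ... | yes _ = u
    ... | no _ = w
    merge-spec : ∀ w → (w ≡ v × merge w ≡ u) ⊎ (w ≢ v × merge w ≡ w)
    merge-spec w with w ≟ v
    ... | yes w≡v = inj₁ (w≡v , refl)
    ... | no w≢v = inj₂ (w≢v , refl)
    merge≢v : ∀ w → v ≢ merge w
    merge≢v w with merge-spec w
    ... | inj₁ (_ , mw≡u) = λ v≡mw → u≢v (sym (trans v≡mw mw≡u))
    ... | inj₂ (w≢v , mw≡w) = λ v≡mw → w≢v (sym (trans v≡mw mw≡w))
    colour : Fin (suc n) → Fin n
    colour w = punchOut (merge≢v w)
    merge-injective : ∀ a b → colour a ≡ colour b → merge a ≡ merge b
    merge-injective a b = punchOut-injective (merge≢v a) (merge≢v b)
    proper : ProperColoring G colour
    proper a b ab ca≡cb with merge-spec a | merge-spec b | merge-injective a b ca≡cb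
    ... | inj₁ (refl , _) | inj₁ (refl , _) | _ = Adj-irrefl G ab
    ... | inj₁ (refl , ma≡u) | inj₂ (_ , mb≡b) | ma≡mb = ¬uv (Adj-sym G (subst (Adj G v) (trans (sym mb≡b) (trans (sym ma≡mb) ma≡u)) ab))
    ... | inj₂ (_ , ma≡a) | inj₁ (refl , mb≡u) | ma≡mb = ¬uv (subst (λ z → Adj G z v) (trans (sym ma≡a) (trans ma≡mb mb≡u)) ab)
    ... | inj₂ (_ , ma≡a) | inj₂ (_ , mb≡b) | ma≡mb = Adj⇒≢ G ab (trans (sym ma≡a) (trans ma≡mb mb≡b))
    merged-colouring : ∃[ R ] (MaximalIrredundant G R × v ∉ R) → IrrColorable G n
    merged-colouring (R , mir , v∉R) = colour , proper , R , mir , rainbow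
      where
      rainbow : ∀ a b → a ∈ R → b ∈ R → a ≢ b → colour a ≢ colour b
      rainbow a b a∈R b∈R a≢b ca≡cb with merge-spec a | merge-spec b
      ... | inj₁ (refl , _) | _ = v∉R a∈R
      ... | _ | inj₁ (refl , _) = v∉R b∈R
      ... | inj₂ (_ , ma≡a) | inj₂ (_ , mb≡b) = a≢b (trans (sym ma≡a) (trans (merge-injective a b ca≡cb) mb≡b))

χ≡n⇒complete : ∀ {n} (G : Graph n) → NoIsolated G → IsChiI G n → Complete G
χ≡n⇒complete {suc n} G noIsolated (_ , minimal) u v u≢v with adj? G u v
... | yes uv = uv
... | no ¬uv = ⊥-elim (1+n≰n (minimal n (nonadjacent⇒irrColorable-pred G noIsolated u≢v ¬uv)))

complete⇒χ≡n : ∀ {n} (G : Graph n) → Complete G → IsChiI G n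
complete⇒χ≡n G complete = irrColorable-n G , λ m → complete⇒n≤colours G complete

theorem3 : ∀ (n : ℕ) (G : Graph n) → 2 ≤ n → Connected G → NoIsolated G →
    -- χ_i(G) exists
    (∃[ k ] IsChiI G k) ×
    -- 1. 2 ≤ χ_i(G) ≤ n
    (∀ k → IsChiI G k → 2 ≤ k × k ≤ n) ×
    -- 2. χ_i(G) = n iff G = K_n
    (IsChiI G n ⇔ Complete G) ×
    -- 3. stars have χ_i = 2
    (IsStar G → IsChiI G 2) ×
    -- 3. for non-stars: (i) ⇔ (ii) and (i) ⇔ (iii)
    (¬ IsStar G →
      (IsChiI G 2 ⇔ (∃[ side ] (IsBipartition G side × (Property𝔍₁ G side ⊎ Property𝔍₂ G side)))) ×
      (IsChiI G 2 ⇔ (InF₁ G ⊎ InF₂ G ⊎ InF₃ G)))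
theorem3 n G 2≤n _ noIsolated =
  least-witness (irrColorable? G) n (irrColorable-n G) ,
  (λ k (colourable , minimal) → IrrColorable⇒2≤ G noIsolated v₀ colourable , minimal n (irrColorable-n G)) ,
  mk⇔ (χ≡n⇒complete G noIsolated) (complete⇒χ≡n G) ,
  star⇒χ≡2 G noIsolated ,
  λ ¬star → χ≡2⇔𝔍 G v₀ noIsolated ¬star , 𝔍⇔F G ¬star ⇔-∘ χ≡2⇔𝔍 G v₀ noIsolated ¬star
  where
  v₀ : Fin n
  v₀ = fromℕ< 2≤n
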